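{- Let $G_1=G$ be an $r$-regular graph of order $p$ with $r\ge 2$ and $\chi_{la}(G)=\chi(G)=\chi$. For $k\ge 2$, let $G_k=G_{k-1}\vee G_{k-1}$ (the join of two vertex-disjoint copies of $G_{k-1}$). Then $G_k$ is an $(r+(2^{k-1}-1)p)$-regular graph of order $2^{k-1}p$ with $\chi_{la}(G_k)=\chi(G_k)=2^{k-1}\chi$.
   Context: The join $G\vee H$ of vertex-disjoint graphs has vertex set $V(G)\cup V(H)$ and edge set $E(G)\cup E(H)\cup\{uv:u\in V(G),v\in V(H)\}$. $\chi$ is the chromatic number. For a simple graph with $q$ edges, a bijection $f:E\to\{1,\dots,q\}$ is a local antimagic labeling if $f^+(u)\neq f^+(v)$ for every edge $uv$, where $f^+(u)=\sum_{e\ni u} f(e)$; $\chi_{la}$ is the minimum number of distinct values of $f^+$ over all local antimagic labelings. -}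

module Defs where

open import Data.Nat using (ℕ; zero; suc; _+_; _*_; _≤_; _<ᵇ_; _≟_)
open import Data.Bool using (Bool; true; false; if_then_else_; _∧_; _∨_)
open import Data.Fin using (Fin; toℕ; splitAt)
open import Data.Fin.Permutation using (Permutation′; _⟨$⟩ʳ_)
open import Data.List using (List; []; _∷_; [_]; length; map; concatMap; allFin; deduplicate; lookup)
open import Data.Nat.ListAction using (sum)
open import Data.Product using (_×_; _,_; Σ; ∃; proj₁; proj₂)
open import Data.Sum using (inj₁; inj₂)
open import Relation.Binary.PropositionalEquality using (_≡_; _≢_; refl)

record Graph (n : ℕ) : Set where
  field
    adj    : Fin n → Fin n → Bool
    sym    : ∀ u v → adj u v ≡ adj v u
    irrefl : ∀ u → adj u u ≡ false
open Graph public

degree : ∀ {n} → Graph n → Fin n → ℕ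
degree G u = sum (map (λ v → if adj G u v then 1 else 0) (allFin _))

Regular : ∀ {n} → Graph n → ℕ → Set
Regular G r = ∀ u → degree G u ≡ r

-- Join of two vertex-disjoint graphs: vertices of G are Fin m, of H the shifted Fin n.
joinAdj : ∀ {m n} → Graph m → Graph n → Fin (m + n) → Fin (m + n) → Bool
joinAdj {m} G H x y with splitAt m x | splitAt m y
... | inj₁ a | inj₁ b = adj G a b
... | inj₂ a | inj₂ b = adj H a b
... | inj₁ _ | inj₂ _ = true
... | inj₂ _ | inj₁ _ = true

joinSym : ∀ {m n} (G : Graph m) (H : Graph n) x y → joinAdj G H x y ≡ joinAdj G H y x
joinSym {m} G H x y with splitAt m x | splitAt m y
... | inj₁ a | inj₁ b = sym G a b
... | inj₂ a | inj₂ b = sym H a b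
... | inj₁ _ | inj₂ _ = refl
... | inj₂ _ | inj₁ _ = refl

joinIrrefl : ∀ {m n} (G : Graph m) (H : Graph n) x → joinAdj G H x x ≡ false
joinIrrefl {m} G H x with splitAt m x
... | inj₁ a = irrefl G a
... | inj₂ a = irrefl H a

_∨ᴳ_ : ∀ {m n} → Graph m → Graph n → Graph (m + n)
G ∨ᴳ H = record { adj = joinAdj G H ; sym = joinSym G H ; irrefl = joinIrrefl G H }

dbl : ℕ → ℕ → ℕ
dbl zero p = p
dbl (suc i) p = dbl i p + dbl i p

-- iter i G = G_{i+1} in the paper's notation (G_1 = G, G_k = G_{k-1} ∨ G_{k-1})
iter : ∀ {p} (i : ℕ) → Graph p → Graph (dbl i p)
iter zero G = G
iter (suc i) G = iter i G ∨ᴳ iter i G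

ProperColoring : ∀ {n} → Graph n → (c : ℕ) → (Fin n → Fin c) → Set
ProperColoring G c col = ∀ u v → adj G u v ≡ true → col u ≢ col v

IsChromaticNumber : ∀ {n} → Graph n → ℕ → Set
IsChromaticNumber {n} G χ =
  Σ (Fin n → Fin χ) (ProperColoring G χ) ×
  (∀ c (col : Fin n → Fin c) → ProperColoring G c col → χ ≤ c)

-- Edge list: unordered edges {i,j} represented as (i , j) with i < j.
edges : ∀ {n} → Graph n → List (Fin n × Fin n)
edges {n} G = concatMap (λ i → concatMap (λ j →
  if adj G i j ∧ (toℕ i <ᵇ toℕ j) then [ (i , j) ] else []) (allFin n)) (allFin n)

size : ∀ {n} → Graph n → ℕ
size G = length (edges G)

-- A bijection f : E → {1,…,q}: edge number e (in the list 'edges G') gets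
-- label 1 + π(e) for a permutation π of Fin q.
EdgeLabeling : ∀ {n} → Graph n → Set
EdgeLabeling G = Permutation′ (size G)

label : ∀ {n} (G : Graph n) → EdgeLabeling G → Fin (size G) → ℕ
label G π e = suc (toℕ (π ⟨$⟩ʳ e))

_=ᵇ_ : ∀ {n} → Fin n → Fin n → Bool
a =ᵇ b = Data.Nat._≡ᵇ_ (toℕ a) (toℕ b)

incident : ∀ {n} → Fin n → Fin n × Fin n → Bool
incident u (a , b) = (u =ᵇ a) ∨ (u =ᵇ b)

vertexSum : ∀ {n} (G : Graph n) → EdgeLabeling G → Fin n → ℕ
vertexSum G π u = sum (map (λ e → if incident u (lookup (edges G) e) then label G π e else 0)
                           (allFin (size G)))

IsLocalAntimagic : ∀ {n} (G : Graph n) → EdgeLabeling G → Set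
IsLocalAntimagic G π = ∀ u v → adj G u v ≡ true → vertexSum G π u ≢ vertexSum G π v

numColors : ∀ {n} (G : Graph n) → EdgeLabeling G → ℕ
numColors {n} G π = length (deduplicate _≟_ (map (vertexSum G π) (allFin n)))

IsLocalAntimagicChromaticNumber : ∀ {n} → Graph n → ℕ → Set
IsLocalAntimagicChromaticNumber G c =
  Σ (EdgeLabeling G) (λ π → IsLocalAntimagic G π × numColors G π ≡ c) ×
  (∀ π → IsLocalAntimagic G π → c ≤ numColors G π)

{-# OPTIONS --safe #-}

-- Let f be a local antimagic labeling of the r-regular graph G of order p with q edges and χ
-- vertex sums. Label G ∨ G by keeping f on the first copy, putting q + 1 + M a b on the edge
-- joining a in the first copy to b in the second, and q + p² + f on the second copy, where M is
-- a semi-magic square with entries 0, …, p² − 1 (one exists for every order except 2, and p = 2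
-- is impossible when r ≥ 2). The cross edges add the same constant to every vertex sum, and the
-- second copy is further shifted by r(q + p²), which exceeds every first-copy sum f⁺(a) ≤ rq.
-- Hence the labeling is local antimagic with at most 2χ vertex sums, while every local antimagic
-- labeling induces a proper colouring and χ(G ∨ G) = 2χ. Iterating the join gives the theorem.

module Submission where

open import Data.Bool using (Bool; true; false; if_then_else_; _∧_; _∨_)
open import Data.Bool.Properties using (T-≡)
open import Data.Empty using (⊥; ⊥-elim)
open import Data.Fin as Fin using (Fin; zero; suc; _↑ˡ_; _↑ʳ_; splitAt; toℕ; fromℕ<; punchOut)
open import Data.Fin.Permutation using (Permutation′; _⟨$⟩ʳ_; _⟨$⟩ˡ_; permutation; inverseˡ)
open import Data.Fin.Properties
  using (any?; all?; join-splitAt; splitAt-↑ˡ; splitAt-↑ʳ; toℕ-↑ˡ; toℕ-↑ʳ; ↑ˡ-injective; ↑ʳ-injective;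
         injective⇒≤; punchOut-injective; toℕ-fromℕ<; fromℕ<-injective; toℕ<n; toℕ-injective)
open import Data.List
  using (List; []; _∷_; [_]; _++_; allFin; map; tabulate; lookup; length; deduplicate; concatMap; upTo)
open import Data.List.Membership.Propositional using (_∈_; lose)
open import Data.List.Membership.Propositional.Properties
  using (∈-lookup; ∈-concatMap⁺; ∈-upTo⁺; ∈-++⁻; ∈-++⁺ˡ; ∈-++⁺ʳ; ∈-map⁻; ∈-map⁺; ∈-allFin;
         ∈-deduplicate⁻; ∈-deduplicate⁺)
open import Data.List.Properties using (map-tabulate; map-++; length-++; length-upTo; length-map)
open import Data.List.Relation.Unary.All as All using (All; []; _∷_)
import Data.List.Relation.Unary.All.Properties as Allₚ
open import Data.List.Relation.Unary.Any using (index; here)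
open import Data.List.Relation.Unary.Any.Properties using (lookup-index)
open import Data.List.Relation.Unary.Unique.Propositional using (Unique; []; _∷_)
import Data.List.Relation.Unary.Unique.Propositional.Properties as Uniqueₚ
open import Data.List.Relation.Unary.Unique.DecPropositional.Properties using (deduplicate-!)
open import Data.Nat
  using (ℕ; zero; suc; _+_; _*_; _^_; _∸_; _≤_; _<_; z≤n; s≤s; z<s; NonZero; >-nonZero; _≟_; _<?_; _<ᵇ_)
open import Data.Nat.Properties
open import Algebra.Properties.CommutativeMonoid.Sum +-0-commutativeMonoid
  using (sum-syntax; sum-permute) renaming (sum to ∑)
open import Algebra.Properties.CommutativeSemigroup +-commutativeSemigroup using (interchange)
open import Data.Nat.DivMod using (_%_; _/_; [m+kn]%n≡m%n; m≡m%n+[m/n]*n; m<n⇒m%n≡m; %-distribˡ-+; m%n<n)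
open import Data.Nat.Divisibility using (_∣_; divides; >⇒∤)
open import Data.Nat.Induction using (<-rec)
open import Data.Nat.ListAction using (sum)
open import Data.Nat.ListAction.Properties using (sum-++)
open import Data.Nat.Solver using (module +-*-Solver)
open import Data.Product using (Σ; ∃; _×_; _,_; proj₁; proj₂)
open import Data.Product.Properties using (≡-dec)
open import Data.Sum using (_⊎_; inj₁; inj₂; [_,_]′)
open import Data.Vec as Vec using (Vec; []; _∷_)
open import Function using (_∘_; id)
open import Function.Bundles using (Equivalence)
open import Function.Definitions using (Injective)
open import Relation.Binary using (tri<; tri≈; tri>)
open import Relation.Binary.PropositionalEquality
  using (_≡_; _≢_; refl; sym; trans; cong; cong₂; subst; subst₂; module ≡-Reasoning)
open import Relation.Nullary using (Dec; yes; no; ¬_; contradiction)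
open import Relation.Nullary.Decidable using (toWitness; _×-dec_; _→-dec_)

open import Defs hiding (sym)

-- Finite sums

sum-tabulate : ∀ n (f : Fin n → ℕ) → sum (tabulate f) ≡ ∑[ i < n ] f i
sum-tabulate zero    f = refl
sum-tabulate (suc n) f = cong (f zero +_) (sum-tabulate n (f ∘ suc))

sum-map-allFin : ∀ n (f : Fin n → ℕ) → sum (map f (allFin n)) ≡ ∑[ i < n ] f i
sum-map-allFin n f = trans (cong sum (map-tabulate id f)) (sum-tabulate n f)

∑-cong : ∀ n {f g : Fin n → ℕ} → (∀ i → f i ≡ g i) → ∑[ i < n ] f i ≡ ∑[ i < n ] g i
∑-cong zero    f≗g = refl
∑-cong (suc n) f≗g = cong₂ _+_ (f≗g zero) (∑-cong n (f≗g ∘ suc))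

∑-mono-≤ : ∀ n {f g : Fin n → ℕ} → (∀ i → f i ≤ g i) → ∑[ i < n ] f i ≤ ∑[ i < n ] g i
∑-mono-≤ zero    f≤g = z≤n
∑-mono-≤ (suc n) f≤g = +-mono-≤ (f≤g zero) (∑-mono-≤ n (f≤g ∘ suc))

∑-distrib-+ : ∀ n (f g : Fin n → ℕ) → ∑[ i < n ] (f i + g i) ≡ ∑[ i < n ] f i + ∑[ i < n ] g i
∑-distrib-+ zero    f g = refl
∑-distrib-+ (suc n) f g = trans (cong (f zero + g zero +_) (∑-distrib-+ n (f ∘ suc) (g ∘ suc)))
                                (interchange (f zero) (g zero) _ _)

∑-const : ∀ n c → ∑[ i < n ] c ≡ n * c
∑-const zero    c = refl
∑-const (suc n) c = cong (c +_) (∑-const n c)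

∑-zero : ∀ n → ∑[ i < n ] 0 ≡ 0
∑-zero n = trans (∑-const n 0) (*-zeroʳ n)

∑-distribˡ-* : ∀ n c (f : Fin n → ℕ) → ∑[ i < n ] (c * f i) ≡ c * ∑[ i < n ] f i
∑-distribˡ-* zero    c f = sym (*-zeroʳ c)
∑-distribˡ-* (suc n) c f = trans (cong (c * f zero +_) (∑-distribˡ-* n c (f ∘ suc)))
                                 (sym (*-distribˡ-+ c (f zero) _))

∑-++ : ∀ m n (f : Fin (m + n) → ℕ) → ∑[ i < m + n ] f i ≡ ∑[ i < m ] f (i ↑ˡ n) + ∑[ j < n ] f (m ↑ʳ j)
∑-++ zero    n f = refl
∑-++ (suc m) n f = trans (cong (f zero +_) (∑-++ m n (f ∘ suc))) (sym (+-assoc (f zero) _ _))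

∑-comm : ∀ m n (f : Fin m → Fin n → ℕ) → ∑[ i < m ] ∑[ j < n ] f i j ≡ ∑[ j < n ] ∑[ i < m ] f i j
∑-comm zero    n f = sym (∑-zero n)
∑-comm (suc m) n f = trans (cong (∑[ j < n ] f zero j +_) (∑-comm m n (f ∘ suc)))
                           (sym (∑-distrib-+ n (f zero) (λ j → ∑[ i < m ] f (suc i) j)))

_≟ₚ_ : ∀ {n} (x y : Fin n × Fin n) → Dec (x ≡ y)
_≟ₚ_ = ≡-dec Fin._≟_ Fin._≟_

_when_ : ℕ → Bool → ℕ
x when b = if b then x else 0

when-distrib-+ : ∀ x y b → (x + y) when b ≡ (x when b) + (y when b)
when-distrib-+ x y true  = refl
when-distrib-+ x y false = refl

∑-when : ∀ n b (f : Fin n → ℕ) → ∑[ i < n ] (f i when b) ≡ (∑[ i < n ] f i) when b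
∑-when n true  f = refl
∑-when n false f = ∑-zero n

∑-when-scale : ∀ n (f : Fin n → Bool) c → ∑[ i < n ] (c when f i) ≡ ∑[ i < n ] (1 when f i) * c
∑-when-scale zero    f c = refl
∑-when-scale (suc n) f c = trans (cong₂ _+_ (when-scale (f zero)) (∑-when-scale n (f ∘ suc) c))
                                 (sym (*-distribʳ-+ c (1 when f zero) _))
  where
  when-scale : ∀ b → c when b ≡ (1 when b) * c
  when-scale true  = sym (*-identityˡ c)
  when-scale false = refl

∑-δ : ∀ n (u : Fin n) (g : Fin n → ℕ) → ∑[ i < n ] (g i when (u =ᵇ i)) ≡ g u
∑-δ (suc n) zero    g = trans (cong (g zero +_) (∑-zero n)) (+-identityʳ (g zero))
∑-δ (suc n) (suc u) g = ∑-δ n u (g ∘ suc)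

injective⇒surjective : ∀ {n} (f : Fin n → Fin n) → Injective _≡_ _≡_ f → ∀ y → ∃ λ x → f x ≡ y
injective⇒surjective {suc n} f inj y with any? (λ x → f x Fin.≟ y)
... | yes found = found
... | no  ∄x    = ⊥-elim (1+n≰n (injective⇒≤ {f = λ x → punchOut (y≢f x)} punchOut∘f-injective))
  where
  y≢f : ∀ x → y ≢ f x
  y≢f x y≡fx = ∄x (x , sym y≡fx)
  punchOut∘f-injective : ∀ {x z} → punchOut (y≢f x) ≡ punchOut (y≢f z) → x ≡ z
  punchOut∘f-injective eq = inj (punchOut-injective (y≢f _) (y≢f _) eq)

injective⇒permutation : ∀ {n} (f : Fin n → Fin n) → Injective _≡_ _≡_ f →
                        Σ (Permutation′ n) λ π → ∀ x → π ⟨$⟩ʳ x ≡ f x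
injective⇒permutation f inj =
  permutation f f⁻¹ (λ y → proj₂ (injective⇒surjective f inj y))
                    (λ x → inj (proj₂ (injective⇒surjective f inj (f x)))) ,
  λ _ → refl
  where
  f⁻¹ = λ y → proj₁ (injective⇒surjective f inj y)

∑-toℕ-injective : ∀ n (f : Fin n → Fin n) → Injective _≡_ _≡_ f → ∑[ i < n ] toℕ (f i) ≡ ∑[ i < n ] toℕ i
∑-toℕ-injective n f inj with injective⇒permutation f inj
... | π , π≗f = trans (∑-cong n (λ i → cong toℕ (sym (π≗f i)))) (sym (sum-permute toℕ π))

∑-reindex : ∀ n (g : ℕ → ℕ) → (∀ {x} → x < n → g x < n) →
            (∀ {x y} → x < n → y < n → g x ≡ g y → x ≡ y) →
            ∑[ i < n ] g (toℕ i) ≡ ∑[ i < n ] toℕ i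
∑-reindex n g g< g-inj = trans (∑-cong n (λ i → sym (toℕ-fromℕ< (g< (toℕ<n i)))))
  (∑-toℕ-injective n (λ i → fromℕ< (g< (toℕ<n i)))
    (λ {i} {j} eq → toℕ-injective (g-inj (toℕ<n i) (toℕ<n j) (fromℕ<-injective _ _ (g< (toℕ<n i)) (g< (toℕ<n j)) eq))))

-- Lists of distinct values and colourings

lookup-injective : ∀ {A : Set} {xs : List A} → Unique xs → ∀ i j → lookup xs i ≡ lookup xs j → i ≡ j
lookup-injective (_    ∷ _) zero    zero    _  = refl
lookup-injective (x∉xs ∷ _) zero    (suc j) eq = ⊥-elim (All.lookup x∉xs (∈-lookup j) eq)
lookup-injective (x∉xs ∷ _) (suc i) zero    eq = ⊥-elim (All.lookup x∉xs (∈-lookup i) (sym eq))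
lookup-injective (_ ∷ uniq) (suc i) (suc j) eq = cong suc (lookup-injective uniq i j eq)

unique⊆⇒length≤ : ∀ {A : Set} {xs ys : List A} → Unique xs → (∀ {x} → x ∈ xs → x ∈ ys) → length xs ≤ length ys
unique⊆⇒length≤ {xs = xs} {ys} uniq xs⊆ys = injective⇒≤ {f = position} position-injective
  where
  position : Fin (length xs) → Fin (length ys)
  position i = index (xs⊆ys (∈-lookup i))
  position-injective : ∀ {i j} → position i ≡ position j → i ≡ j
  position-injective {i} {j} eq = lookup-injective uniq i j (begin
    lookup xs i                  ≡⟨ lookup-index (xs⊆ys (∈-lookup i)) ⟩
    lookup ys (position i)       ≡⟨ cong (lookup ys) eq ⟩
    lookup ys (position j)       ≡⟨ sym (lookup-index (xs⊆ys (∈-lookup j))) ⟩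
    lookup xs j                  ∎)
    where open ≡-Reasoning

numDistinct : List ℕ → ℕ
numDistinct xs = length (deduplicate _≟_ xs)

numDistinct≤ : ∀ {xs ys : List ℕ} → (∀ {x} → x ∈ xs → x ∈ ys) → numDistinct xs ≤ length ys
numDistinct≤ {xs} xs⊆ys = unique⊆⇒length≤ (deduplicate-! _≟_ xs) (xs⊆ys ∘ ∈-deduplicate⁻ _≟_ xs)

numDistinct-++≤ : ∀ {xs ys : List ℕ} c → (∀ {x} → x ∈ xs → x < c) → (∀ {y} → y ∈ ys → y < c) →
                  (∀ {x} → x ∈ xs → x ∈ ys → ⊥) → numDistinct xs + numDistinct ys ≤ c
numDistinct-++≤ {xs} {ys} c xs<c ys<c disjoint = subst₂ _≤_ (length-++ dxs) (length-upTo c)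
  (unique⊆⇒length≤ (Uniqueₚ.++⁺ (deduplicate-! _≟_ xs) (deduplicate-! _≟_ ys) disjoint′) ⊆upTo)
  where
  dxs = deduplicate _≟_ xs
  dys = deduplicate _≟_ ys
  disjoint′ : ∀ {x} → ¬ (x ∈ dxs × x ∈ dys)
  disjoint′ (x∈ , y∈) = disjoint (∈-deduplicate⁻ _≟_ xs x∈) (∈-deduplicate⁻ _≟_ ys y∈)
  ⊆upTo : ∀ {x} → x ∈ dxs ++ dys → x ∈ upTo c
  ⊆upTo x∈ with ∈-++⁻ dxs x∈
  ... | inj₁ x∈dxs = ∈-upTo⁺ (xs<c (∈-deduplicate⁻ _≟_ xs x∈dxs))
  ... | inj₂ x∈dys = ∈-upTo⁺ (ys<c (∈-deduplicate⁻ _≟_ ys x∈dys))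

valueColouring : ∀ {n} (g : Fin n → ℕ) → Fin n → Fin (numDistinct (map g (allFin n)))
valueColouring g u = index (∈-deduplicate⁺ _≟_ (∈-map⁺ g (∈-allFin u)))

valueColouring-reflects : ∀ {n} (g : Fin n → ℕ) u v → valueColouring g u ≡ valueColouring g v → g u ≡ g v
valueColouring-reflects {n} g u v eq = begin
  g u                     ≡⟨ lookup-index (∈-deduplicate⁺ _≟_ (∈-map⁺ g (∈-allFin u))) ⟩
  lookup ds (valueColouring g u) ≡⟨ cong (lookup ds) eq ⟩
  lookup ds (valueColouring g v) ≡⟨ sym (lookup-index (∈-deduplicate⁺ _≟_ (∈-map⁺ g (∈-allFin v)))) ⟩
  g v                     ∎
  where
  open ≡-Reasoning
  ds = deduplicate _≟_ (map g (allFin n))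

chromaticNumber≤numDistinct : ∀ {n} {X : Graph n} {χ} → IsChromaticNumber X χ →
  (g : Fin n → ℕ) → (∀ u v → adj X u v ≡ true → g u ≢ g v) → χ ≤ numDistinct (map g (allFin n))
chromaticNumber≤numDistinct (_ , minimal) g proper = minimal _ (valueColouring g)
  (λ u v uv → proper u v uv ∘ valueColouring-reflects g u v)

chromaticNumber≤numColors : ∀ {n} {X : Graph n} {χ} → IsChromaticNumber X χ →
  ∀ π → IsLocalAntimagic X π → χ ≤ numColors X π
chromaticNumber≤numColors {X = X} isχ π antimagic = chromaticNumber≤numDistinct {X = X} isχ (vertexSum X π) antimagic

-- Edge lists and vertex sums

unique-concatMap : ∀ {A B : Set} (tag : B → A) (f : A → List B) {xs} → Unique xs → (∀ x → Unique (f x)) →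
                   (∀ x → All (λ y → tag y ≡ x) (f x)) → Unique (concatMap f xs)
unique-concatMap tag f {[]}     _          _        _      = []
unique-concatMap tag f {x ∷ xs} (x∉xs ∷ u) f-unique f-tags =
  Uniqueₚ.++⁺ (f-unique x) (unique-concatMap tag f u f-unique f-tags) disjoint
  where
  tagsOutside : ∀ {ys} → All (x ≢_) ys → All (λ y → tag y ≢ x) (concatMap f ys)
  tagsOutside []             = []
  tagsOutside (x≢z ∷ x∉ys) =
    Allₚ.++⁺ (All.map (λ tag≡z tag≡x → x≢z (trans (sym tag≡x) tag≡z)) (f-tags _)) (tagsOutside x∉ys)
  disjoint : ∀ {y} → ¬ (y ∈ f x × y ∈ concatMap f xs)
  disjoint (y∈fx , y∈rest) = All.lookup (tagsOutside x∉xs) y∈rest (All.lookup (f-tags x) y∈fx)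

sum-map-cong : ∀ {A : Set} (xs : List A) {F G : A → ℕ} → (∀ x → F x ≡ G x) → sum (map F xs) ≡ sum (map G xs)
sum-map-cong []       F≗G = refl
sum-map-cong (x ∷ xs) F≗G = cong₂ _+_ (F≗G x) (sum-map-cong xs F≗G)

sum-map-concatMap : ∀ {A B : Set} (F : B → ℕ) (f : A → List B) xs →
                    sum (map F (concatMap f xs)) ≡ sum (map (λ x → sum (map F (f x))) xs)
sum-map-concatMap F f []       = refl
sum-map-concatMap F f (x ∷ xs) = begin
  sum (map F (f x ++ concatMap f xs))                  ≡⟨ cong sum (map-++ F (f x) _) ⟩
  sum (map F (f x) ++ map F (concatMap f xs))          ≡⟨ sum-++ (map F (f x)) _ ⟩
  sum (map F (f x)) + sum (map F (concatMap f xs))     ≡⟨ cong (sum (map F (f x)) +_) (sum-map-concatMap F f xs) ⟩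
  sum (map F (f x)) + sum (map (λ x → sum (map F (f x))) xs) ∎
  where open ≡-Reasoning

length≡sum-map-1 : ∀ {A : Set} (xs : List A) → length xs ≡ sum (map (λ _ → 1) xs)
length≡sum-map-1 []       = refl
length≡sum-map-1 (x ∷ xs) = cong suc (length≡sum-map-1 xs)

sum-lookup : ∀ {A : Set} (xs : List A) (F : A → ℕ) → ∑[ e < length xs ] F (lookup xs e) ≡ sum (map F xs)
sum-lookup []       F = refl
sum-lookup (x ∷ xs) F = cong (F x +_) (sum-lookup xs F)

<⇒<ᵇ≡true : ∀ {m n} → m < n → (m <ᵇ n) ≡ true
<⇒<ᵇ≡true m<n = Equivalence.to T-≡ (<⇒<ᵇ m<n)

≮⇒<ᵇ≡false : ∀ {m n} → ¬ m < n → (m <ᵇ n) ≡ false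
≮⇒<ᵇ≡false {m} {n} m≮n with m <ᵇ n in m<ᵇn
... | true  = contradiction (<ᵇ⇒< m n (Equivalence.from T-≡ m<ᵇn)) m≮n
... | false = refl

+<ᵇ+ : ∀ k m n → ((k + m) <ᵇ (k + n)) ≡ (m <ᵇ n)
+<ᵇ+ zero    m n = refl
+<ᵇ+ (suc k) m n = +<ᵇ+ k m n

sortPair : ∀ {n} → Fin n → Fin n → Fin n × Fin n
sortPair u v = if toℕ u <ᵇ toℕ v then (u , v) else (v , u)

sortPair-< : ∀ {n} {u v : Fin n} → toℕ u < toℕ v → sortPair u v ≡ (u , v)
sortPair-< u<v rewrite <⇒<ᵇ≡true u<v = refl

sortPair-≮ : ∀ {n} {u v : Fin n} → ¬ toℕ u < toℕ v → sortPair u v ≡ (v , u)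
sortPair-≮ u≮v rewrite ≮⇒<ᵇ≡false u≮v = refl

sortPair-comm : ∀ {n} (u v : Fin n) → sortPair u v ≡ sortPair v u
sortPair-comm u v with <-cmp (toℕ u) (toℕ v)
... | tri< u<v _ v≮u = trans (sortPair-< u<v) (sym (sortPair-≮ v≮u))
... | tri≈ _ u≡v _   rewrite toℕ-injective u≡v = refl
... | tri> u≮v _ v<u = trans (sortPair-≮ u≮v) (sym (sortPair-< v<u))

module EdgeList {n : ℕ} (X : Graph n) where

  isEdge : Fin n → Fin n → Bool
  isEdge i j = adj X i j ∧ (toℕ i <ᵇ toℕ j)

  edgesFrom : Fin n → List (Fin n × Fin n)
  edgesFrom i = concatMap (λ j → if isEdge i j then [ (i , j) ] else []) (allFin n)

  private
    sum-map-if : ∀ (F : Fin n × Fin n → ℕ) b x → sum (map F (if b then [ x ] else [])) ≡ F x when b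
    sum-map-if F true  x = +-identityʳ (F x)
    sum-map-if F false x = refl

    All-if : ∀ {P : Fin n × Fin n → Set} b x → (b ≡ true → P x) → All P (if b then [ x ] else [])
    All-if true  x p = p refl ∷ []
    All-if false x p = []

    All-concatMap-allFin : ∀ {P : Fin n × Fin n → Set} (f : Fin n → List (Fin n × Fin n)) →
                           (∀ i → All P (f i)) → All P (concatMap f (allFin n))
    All-concatMap-allFin f Pf = Allₚ.concat⁺ (Allₚ.map⁺ {xs = allFin n} {f = f} (All.tabulate λ {i} _ → Pf i))

    Unique-if : ∀ b (x : Fin n × Fin n) → Unique (if b then [ x ] else [])
    Unique-if true  x = [] ∷ []
    Unique-if false x = []

  sum-map-edges : (F : Fin n × Fin n → ℕ) → sum (map F (edges X)) ≡ ∑[ i < n ] ∑[ j < n ] (F (i , j) when isEdge i j)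
  sum-map-edges F =
    trans (sum-map-concatMap F edgesFrom (allFin n))
      (trans (sum-map-cong (allFin n) λ i →
                trans (sum-map-concatMap F _ (allFin n))
                  (trans (sum-map-cong (allFin n) (λ j → sum-map-if F (isEdge i j) (i , j)))
                         (sum-map-allFin n _)))
             (sum-map-allFin n _))

  edges-isEdge : All (λ (i , j) → isEdge i j ≡ true) (edges X)
  edges-isEdge = All-concatMap-allFin edgesFrom λ i →
                 All-concatMap-allFin _ λ j → All-if (isEdge i j) (i , j) id

  edges-unique : Unique (edges X)
  edges-unique = unique-concatMap proj₁ edgesFrom (Uniqueₚ.allFin⁺ n)
    (λ i → unique-concatMap proj₂ _ (Uniqueₚ.allFin⁺ n) (λ j → Unique-if (isEdge i j) (i , j))
                                                    (λ j → All-if (isEdge i j) (i , j) (λ _ → refl)))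
    (λ i → All-concatMap-allFin _ λ j → All-if (isEdge i j) (i , j) (λ _ → refl))

  ∈-edges : ∀ {i j} → isEdge i j ≡ true → (i , j) ∈ edges X
  ∈-edges {i} {j} ij = ∈-concatMap⁺ edgesFrom (lose (∈-allFin i) (∈-concatMap⁺ _ (lose (∈-allFin j) here′)))
    where
    here′ : (i , j) ∈ (if isEdge i j then [ (i , j) ] else [])
    here′ rewrite ij = here refl

  size≡∑ : size X ≡ ∑[ i < n ] ∑[ j < n ] (1 when isEdge i j)
  size≡∑ = trans (length≡sum-map-1 (edges X)) (sum-map-edges (λ _ → 1))

  isEdge⇒< : ∀ {i j} → isEdge i j ≡ true → toℕ i < toℕ j
  isEdge⇒< {i} {j} ij with adj X i j
  ... | true = <ᵇ⇒< (toℕ i) (toℕ j) (Equivalence.from T-≡ ij)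

  private
    =ᵇ⇒≡ : ∀ {a b : Fin n} → (a =ᵇ b) ≡ true → a ≡ b
    =ᵇ⇒≡ {a} {b} eq = toℕ-injective (≡ᵇ⇒≡ (toℕ a) (toℕ b) (Equivalence.from T-≡ eq))

  adj⇒≢ : ∀ {u v} → adj X u v ≡ true → toℕ u ≢ toℕ v
  adj⇒≢ {u} uv u≡v = contradiction (trans (sym (Graph.irrefl X u)) (trans (cong (adj X u) (toℕ-injective u≡v)) uv)) λ ()

  when-incident : ∀ u i j x → (x when incident u (i , j)) when isEdge i j ≡
                  ((x when isEdge i j) when (u =ᵇ i)) + ((x when isEdge i j) when (u =ᵇ j))
  when-incident u i j x with isEdge i j in ij | u =ᵇ i in ui | u =ᵇ j in uj
  ... | false | false | false = refl
  ... | false | false | true  = refl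
  ... | false | true  | false = refl
  ... | false | true  | true  = refl
  ... | true  | false | false = refl
  ... | true  | false | true  = refl
  ... | true  | true  | false = sym (+-identityʳ x)
  ... | true  | true  | true  =
    contradiction (isEdge⇒< ij) (<-irrefl (cong toℕ (trans (sym (=ᵇ⇒≡ {u} ui)) (=ᵇ⇒≡ {u} uj))))

  when-isEdge-either : ∀ u v x → (x when isEdge u v) + (x when isEdge v u) ≡ x when adj X u v
  when-isEdge-either u v x rewrite Graph.sym X v u with adj X u v in uv
  ... | false = refl
  ... | true with <-cmp (toℕ u) (toℕ v)
  ...   | tri< u<v _ v≮u rewrite <⇒<ᵇ≡true u<v | ≮⇒<ᵇ≡false v≮u = +-identityʳ x
  ...   | tri> u≮v _ v<u rewrite <⇒<ᵇ≡true v<u | ≮⇒<ᵇ≡false u≮v = refl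
  ...   | tri≈ _ u≡v _ = contradiction u≡v (adj⇒≢ uv)

  sum-incident : (w : Fin n × Fin n → ℕ) → (∀ u v → w (u , v) ≡ w (v , u)) → ∀ u →
                 sum (map (λ x → w x when incident u x) (edges X)) ≡ ∑[ v < n ] (w (u , v) when adj X u v)
  sum-incident w w-sym u = begin
    sum (map (λ x → w x when incident u x) (edges X))
      ≡⟨ sum-map-edges _ ⟩
    ∑[ i < n ] ∑[ j < n ] ((w (i , j) when incident u (i , j)) when isEdge i j)
      ≡⟨ ∑-cong n (λ i → trans (∑-cong n (λ j → when-incident u i j (w (i , j)))) (∑-distrib-+ n _ _)) ⟩
    ∑[ i < n ] (∑[ j < n ] (K i j when (u =ᵇ i)) + ∑[ j < n ] (K i j when (u =ᵇ j)))
      ≡⟨ ∑-distrib-+ n _ _ ⟩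
    ∑[ i < n ] ∑[ j < n ] (K i j when (u =ᵇ i)) + ∑[ i < n ] ∑[ j < n ] (K i j when (u =ᵇ j))
      ≡⟨ cong₂ _+_ (trans (∑-cong n (λ i → ∑-when n (u =ᵇ i) (K i))) (∑-δ n u (λ i → ∑[ j < n ] K i j)))
                   (trans (∑-comm n n _) (trans (∑-cong n (λ j → ∑-when n (u =ᵇ j) (λ i → K i j)))
                                                (∑-δ n u (λ j → ∑[ i < n ] K i j)))) ⟩
    ∑[ v < n ] K u v + ∑[ v < n ] K v u
      ≡⟨ sym (∑-distrib-+ n _ _) ⟩
    ∑[ v < n ] (K u v + K v u)
      ≡⟨ ∑-cong n (λ v → trans (cong (K u v +_) (cong (_when isEdge v u) (w-sym v u)))
                                (when-isEdge-either u v (w (u , v)))) ⟩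
    ∑[ v < n ] (w (u , v) when adj X u v) ∎
    where
    open ≡-Reasoning
    K : Fin n → Fin n → ℕ
    K i j = w (i , j) when isEdge i j

  isEdge-sortPair : ∀ {u v} → adj X u v ≡ true → isEdge (proj₁ (sortPair u v)) (proj₂ (sortPair u v)) ≡ true
  isEdge-sortPair {u} {v} uv with <-cmp (toℕ u) (toℕ v)
  ... | tri< u<v _ _ rewrite sortPair-< u<v | uv = <⇒<ᵇ≡true u<v
  ... | tri> u≮v _ v<u rewrite sortPair-≮ u≮v | Graph.sym X v u | uv = <⇒<ᵇ≡true v<u
  ... | tri≈ _ u≡v _ = contradiction u≡v (adj⇒≢ uv)

vertexSum-by-weight : ∀ {n} (X : Graph n) (π : EdgeLabeling X) (w : Fin n × Fin n → ℕ) →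
  (∀ u v → w (u , v) ≡ w (v , u)) → (∀ e → label X π e ≡ w (lookup (edges X) e)) →
  ∀ u → vertexSum X π u ≡ ∑[ v < n ] (w (u , v) when adj X u v)
vertexSum-by-weight {n} X π w w-sym label≡w u = begin
  vertexSum X π u
    ≡⟨ sum-map-allFin (size X) _ ⟩
  ∑[ e < size X ] (label X π e when incident u (lookup (edges X) e))
    ≡⟨ ∑-cong (size X) (λ e → cong (_when incident u (lookup (edges X) e)) (label≡w e)) ⟩
  ∑[ e < size X ] (w (lookup (edges X) e) when incident u (lookup (edges X) e))
    ≡⟨ sum-lookup (edges X) _ ⟩
  sum (map (λ x → w x when incident u x) (edges X))
    ≡⟨ EdgeList.sum-incident X w w-sym u ⟩
  ∑[ v < n ] (w (u , v) when adj X u v) ∎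
  where open ≡-Reasoning

label-injective : ∀ {n} (X : Graph n) (π : EdgeLabeling X) {e e′} → label X π e ≡ label X π e′ → e ≡ e′
label-injective X π {e} {e′} eq = begin
  e                          ≡⟨ sym (inverseˡ π) ⟩
  π ⟨$⟩ˡ (π ⟨$⟩ʳ e)          ≡⟨ cong (π ⟨$⟩ˡ_) (toℕ-injective (suc-injective eq)) ⟩
  π ⟨$⟩ˡ (π ⟨$⟩ʳ e′)         ≡⟨ inverseˡ π ⟩
  e′                         ∎
  where open ≡-Reasoning

degree≡∑ : ∀ {n} (X : Graph n) u → degree X u ≡ ∑[ v < n ] (1 when adj X u v)
degree≡∑ {n} X u = sum-map-allFin n _

module LabelWeight {n : ℕ} (X : Graph n) (π : EdgeLabeling X) where
  open EdgeList X

  labelAt : Fin n × Fin n → ℕ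
  labelAt x with any? (λ e → lookup (edges X) e ≟ₚ x)
  ... | yes (e , _) = label X π e
  ... | no  _       = 0

  labelAt-lookup : ∀ e → labelAt (lookup (edges X) e) ≡ label X π e
  labelAt-lookup e with any? (λ e′ → lookup (edges X) e′ ≟ₚ lookup (edges X) e)
  ... | yes (e′ , same) = cong (label X π) (lookup-injective edges-unique e′ e same)
  ... | no  ∄e′         = contradiction (e , refl) ∄e′

  weight : Fin n × Fin n → ℕ
  weight (u , v) = labelAt (sortPair u v)

  weight-sym : ∀ u v → weight (u , v) ≡ weight (v , u)
  weight-sym u v = cong labelAt (sortPair-comm u v)

  weight-lookup : ∀ e → weight (lookup (edges X) e) ≡ label X π e
  weight-lookup e = trans (cong labelAt (sortPair-< (isEdge⇒< (All.lookup edges-isEdge (∈-lookup e)))))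
                          (labelAt-lookup e)

  vertexSum≡∑weight : ∀ u → vertexSum X π u ≡ ∑[ v < n ] (weight (u , v) when adj X u v)
  vertexSum≡∑weight = vertexSum-by-weight X π weight weight-sym (sym ∘ weight-lookup)

  weight-edge : ∀ {u v} → adj X u v ≡ true → ∃ λ e → weight (u , v) ≡ label X π e
  weight-edge uv = index uv∈edges , trans (cong labelAt (lookup-index uv∈edges)) (labelAt-lookup _)
    where uv∈edges = ∈-edges (isEdge-sortPair uv)

  weight-∈ : ∀ {x} → x ∈ edges X → ∃ λ t → weight x ≡ suc t × t < size X
  weight-∈ x∈ = toℕ (π ⟨$⟩ʳ index x∈) , trans (cong weight (lookup-index x∈)) (weight-lookup (index x∈)) , toℕ<n _

  weight-injective : ∀ {x y} → x ∈ edges X → y ∈ edges X → weight x ≡ weight y → x ≡ y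
  weight-injective {x} {y} x∈ y∈ eq = begin
    x                              ≡⟨ lookup-index x∈ ⟩
    lookup (edges X) (index x∈)    ≡⟨ cong (lookup (edges X)) (label-injective X π (begin
      label X π (index x∈)                ≡⟨ sym (weight-lookup (index x∈)) ⟩
      weight (lookup (edges X) (index x∈)) ≡⟨ cong weight (sym (lookup-index x∈)) ⟩
      weight x                             ≡⟨ eq ⟩
      weight y                             ≡⟨ cong weight (lookup-index y∈) ⟩
      weight (lookup (edges X) (index y∈)) ≡⟨ weight-lookup (index y∈) ⟩
      label X π (index y∈)                 ∎)) ⟩
    lookup (edges X) (index y∈)    ≡⟨ sym (lookup-index y∈) ⟩
    y                              ∎
    where open ≡-Reasoning

  degree≤vertexSum : ∀ u → degree X u ≤ vertexSum X π u
  degree≤vertexSum u = subst₂ _≤_ (sym (degree≡∑ X u)) (sym (vertexSum≡∑weight u)) (∑-mono-≤ n term)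
    where
    term : ∀ v → 1 when adj X u v ≤ weight (u , v) when adj X u v
    term v with adj X u v in uv
    ... | false = z≤n
    ... | true  with weight-edge uv
    ...   | e , w≡label = subst (1 ≤_) (sym w≡label) (s≤s z≤n)

  vertexSum≤degree*size : ∀ u → vertexSum X π u ≤ degree X u * size X
  vertexSum≤degree*size u = subst₂ _≤_ (sym (vertexSum≡∑weight u))
    (trans (∑-when-scale n (adj X u) (size X)) (cong (_* size X) (sym (degree≡∑ X u))))
    (∑-mono-≤ n term)
    where
    term : ∀ v → weight (u , v) when adj X u v ≤ size X when adj X u v
    term v with adj X u v in uv
    ... | false = z≤n
    ... | true  with weight-edge uv
    ...   | e , w≡label = subst (_≤ size X) (sym w≡label) (toℕ<n (π ⟨$⟩ʳ e))

labeling-from-weight : ∀ {n} (X : Graph n) (w : Fin n × Fin n → ℕ) →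
  (∀ {x} → x ∈ edges X → ∃ λ t → w x ≡ suc t × t < size X) →
  (∀ {x y} → x ∈ edges X → y ∈ edges X → w x ≡ w y → x ≡ y) →
  Σ (EdgeLabeling X) λ π → ∀ e → label X π e ≡ w (lookup (edges X) e)
labeling-from-weight X w w-range w-injective = π , label≡w
  where
  open EdgeList X using (edges-unique)
  t<q : ∀ e → ∃ λ t → w (lookup (edges X) e) ≡ suc t × t < size X
  t<q e = w-range (∈-lookup e)
  f : Fin (size X) → Fin (size X)
  f e = fromℕ< (proj₂ (proj₂ (t<q e)))
  w≡suc-f : ∀ e → w (lookup (edges X) e) ≡ suc (toℕ (f e))
  w≡suc-f e = trans (proj₁ (proj₂ (t<q e))) (cong suc (sym (toℕ-fromℕ< _)))
  f-injective : Injective _≡_ _≡_ f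
  f-injective {e} {e′} fe≡fe′ = lookup-injective edges-unique e e′
    (w-injective (∈-lookup e) (∈-lookup e′)
      (trans (w≡suc-f e) (trans (cong (suc ∘ toℕ) fe≡fe′) (sym (w≡suc-f e′)))))
  π = proj₁ (injective⇒permutation f f-injective)
  label≡w : ∀ e → label X π e ≡ w (lookup (edges X) e)
  label≡w e = trans (cong (suc ∘ toℕ) (proj₂ (injective⇒permutation f f-injective) e)) (sym (w≡suc-f e))

-- Joins

data JoinView (m n : ℕ) : Fin (m + n) → Set where
  left  : (a : Fin m) → JoinView m n (a ↑ˡ n)
  right : (b : Fin n) → JoinView m n (m ↑ʳ b)

joinView : ∀ m n x → JoinView m n x
joinView m n x = subst (JoinView m n) (join-splitAt m n x) (view (splitAt m x))
  where
  view : ∀ s → JoinView m n (Fin.join m n s)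
  view (inj₁ a) = left a
  view (inj₂ b) = right b

module Join {m n : ℕ} (G : Graph m) (H : Graph n) where

  adj-left-left : ∀ a b → adj (G ∨ᴳ H) (a ↑ˡ n) (b ↑ˡ n) ≡ adj G a b
  adj-left-left a b rewrite splitAt-↑ˡ m a n | splitAt-↑ˡ m b n = refl

  adj-right-right : ∀ a b → adj (G ∨ᴳ H) (m ↑ʳ a) (m ↑ʳ b) ≡ adj H a b
  adj-right-right a b rewrite splitAt-↑ʳ m n a | splitAt-↑ʳ m n b = refl

  adj-left-right : ∀ a b → adj (G ∨ᴳ H) (a ↑ˡ n) (m ↑ʳ b) ≡ true
  adj-left-right a b rewrite splitAt-↑ˡ m a n | splitAt-↑ʳ m n b = refl

  adj-right-left : ∀ b a → adj (G ∨ᴳ H) (m ↑ʳ b) (a ↑ˡ n) ≡ true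
  adj-right-left b a rewrite splitAt-↑ˡ m a n | splitAt-↑ʳ m n b = refl

  private
    ∑-all-adjacent : ∀ k (f : Fin k → Bool) → (∀ i → f i ≡ true) → ∑[ i < k ] (1 when f i) ≡ k
    ∑-all-adjacent k f all = trans (∑-cong k (λ i → cong (1 when_) (all i))) (trans (∑-const k 1) (*-identityʳ k))

  degree-left : ∀ a → degree (G ∨ᴳ H) (a ↑ˡ n) ≡ degree G a + n
  degree-left a = begin
    degree (G ∨ᴳ H) (a ↑ˡ n)
      ≡⟨ trans (degree≡∑ (G ∨ᴳ H) _) (∑-++ m n _) ⟩
    ∑[ b < m ] (1 when adj (G ∨ᴳ H) (a ↑ˡ n) (b ↑ˡ n)) + ∑[ b < n ] (1 when adj (G ∨ᴳ H) (a ↑ˡ n) (m ↑ʳ b))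
      ≡⟨ cong₂ _+_ (trans (∑-cong m (λ b → cong (1 when_) (adj-left-left a b))) (sym (degree≡∑ G a)))
                   (∑-all-adjacent n _ (adj-left-right a)) ⟩
    degree G a + n ∎
    where open ≡-Reasoning

  degree-right : ∀ b → degree (G ∨ᴳ H) (m ↑ʳ b) ≡ degree H b + m
  degree-right b = begin
    degree (G ∨ᴳ H) (m ↑ʳ b)
      ≡⟨ trans (degree≡∑ (G ∨ᴳ H) _) (∑-++ m n _) ⟩
    ∑[ a < m ] (1 when adj (G ∨ᴳ H) (m ↑ʳ b) (a ↑ˡ n)) + ∑[ a < n ] (1 when adj (G ∨ᴳ H) (m ↑ʳ b) (m ↑ʳ a))
      ≡⟨ cong₂ _+_ (∑-all-adjacent m _ (adj-right-left b))
                   (trans (∑-cong n (λ a → cong (1 when_) (adj-right-right b a))) (sym (degree≡∑ H b))) ⟩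
    m + degree H b
      ≡⟨ +-comm m _ ⟩
    degree H b + m ∎
    where open ≡-Reasoning

  module G = EdgeList G
  module H = EdgeList H
  open EdgeList (G ∨ᴳ H) using (isEdge; size≡∑)

  left<right : ∀ (a : Fin m) (b : Fin n) → toℕ a < m + toℕ b
  left<right a b = <-≤-trans (toℕ<n a) (m≤m+n m (toℕ b))

  isEdge-left-left : ∀ a b → isEdge (a ↑ˡ n) (b ↑ˡ n) ≡ G.isEdge a b
  isEdge-left-left a b rewrite adj-left-left a b | toℕ-↑ˡ a n | toℕ-↑ˡ b n = refl

  isEdge-right-right : ∀ a b → isEdge (m ↑ʳ a) (m ↑ʳ b) ≡ H.isEdge a b
  isEdge-right-right a b rewrite adj-right-right a b | toℕ-↑ʳ m a | toℕ-↑ʳ m b | +<ᵇ+ m (toℕ a) (toℕ b) = refl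

  isEdge-left-right : ∀ a b → isEdge (a ↑ˡ n) (m ↑ʳ b) ≡ true
  isEdge-left-right a b rewrite adj-left-right a b | toℕ-↑ˡ a n | toℕ-↑ʳ m b = <⇒<ᵇ≡true (left<right a b)

  isEdge-right-left : ∀ b a → isEdge (m ↑ʳ b) (a ↑ˡ n) ≡ false
  isEdge-right-left b a rewrite adj-right-left b a | toℕ-↑ˡ a n | toℕ-↑ʳ m b = ≮⇒<ᵇ≡false (<⇒≯ (left<right a b))

  size-join : size (G ∨ᴳ H) ≡ size G + m * n + size H
  size-join = begin
    size (G ∨ᴳ H)
      ≡⟨ trans size≡∑ (∑-++ m n (λ x → ∑[ y < m + n ] (1 when isEdge x y))) ⟩
    ∑[ a < m ] ∑[ y < m + n ] (1 when isEdge (a ↑ˡ n) y) + ∑[ b < n ] ∑[ y < m + n ] (1 when isEdge (m ↑ʳ b) y)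
      ≡⟨ cong₂ _+_ (∑-cong m row-left) (∑-cong n row-right) ⟩
    ∑[ a < m ] (∑[ b < m ] (1 when G.isEdge a b) + n) + ∑[ b < n ] ∑[ c < n ] (1 when H.isEdge b c)
      ≡⟨ cong₂ _+_ (trans (∑-distrib-+ m (λ a → ∑[ b < m ] (1 when G.isEdge a b)) (λ _ → n))
                          (cong₂ _+_ (sym G.size≡∑) (∑-const m n)))
                   (sym H.size≡∑) ⟩
    size G + m * n + size H ∎
    where
    open ≡-Reasoning
    row-left : ∀ a → ∑[ y < m + n ] (1 when isEdge (a ↑ˡ n) y) ≡ ∑[ b < m ] (1 when G.isEdge a b) + n
    row-left a = trans (∑-++ m n (λ y → 1 when isEdge (a ↑ˡ n) y))
      (cong₂ _+_ (∑-cong m (λ b → cong (1 when_) (isEdge-left-left a b)))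
                 (∑-all-adjacent n (λ b → isEdge (a ↑ˡ n) (m ↑ʳ b)) (isEdge-left-right a)))
    row-right : ∀ b → ∑[ y < m + n ] (1 when isEdge (m ↑ʳ b) y) ≡ ∑[ c < n ] (1 when H.isEdge b c)
    row-right b = trans (∑-++ m n (λ y → 1 when isEdge (m ↑ʳ b) y))
      (cong₂ _+_ (trans (∑-cong m (λ a → cong (1 when_) (isEdge-right-left b a))) (∑-zero m))
                 (∑-cong n (λ c → cong (1 when_) (isEdge-right-right b c))))

  isChromaticNumber-join : ∀ {χ₁ χ₂} → IsChromaticNumber G χ₁ → IsChromaticNumber H χ₂ →
                           IsChromaticNumber (G ∨ᴳ H) (χ₁ + χ₂)
  isChromaticNumber-join {χ₁} {χ₂} isχ₁@((col₁ , proper₁) , _) isχ₂@((col₂ , proper₂) , _) =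
    (col , proper) , minimal
    where
    col : Fin (m + n) → Fin (χ₁ + χ₂)
    col x with joinView m n x
    ... | left  a = col₁ a ↑ˡ χ₂
    ... | right b = χ₁ ↑ʳ col₂ b
    ↑ˡ≢↑ʳ : ∀ (i : Fin χ₁) (j : Fin χ₂) → i ↑ˡ χ₂ ≢ χ₁ ↑ʳ j
    ↑ˡ≢↑ʳ i j eq = <-irrefl (trans (sym (toℕ-↑ˡ i χ₂)) (trans (cong toℕ eq) (toℕ-↑ʳ χ₁ j)))
                            (<-≤-trans (toℕ<n i) (m≤m+n χ₁ (toℕ j)))
    proper : ProperColoring (G ∨ᴳ H) (χ₁ + χ₂) col
    proper x y xy with joinView m n x | joinView m n y
    ... | left  a | left  b = proper₁ a b (trans (sym (adj-left-left a b)) xy) ∘ ↑ˡ-injective χ₂ _ _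
    ... | left  a | right b = ↑ˡ≢↑ʳ _ _
    ... | right a | left  b = ↑ˡ≢↑ʳ _ _ ∘ sym
    ... | right a | right b = proper₂ a b (trans (sym (adj-right-right a b)) xy) ∘ ↑ʳ-injective χ₁ _ _
    minimal : ∀ c (cl : Fin (m + n) → Fin c) → ProperColoring (G ∨ᴳ H) c cl → χ₁ + χ₂ ≤ c
    minimal c cl cl-proper =
      ≤-trans (+-mono-≤ χ₁≤ χ₂≤) (numDistinct-++≤ c (bounded (_↑ˡ n)) (bounded (m ↑ʳ_)) disjoint)
      where
      g₁ : Fin m → ℕ
      g₁ a = toℕ (cl (a ↑ˡ n))
      g₂ : Fin n → ℕ
      g₂ b = toℕ (cl (m ↑ʳ b))
      χ₁≤ = chromaticNumber≤numDistinct {X = G} isχ₁ g₁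
              (λ a b ab → cl-proper _ _ (trans (adj-left-left a b) ab) ∘ toℕ-injective)
      χ₂≤ = chromaticNumber≤numDistinct {X = H} isχ₂ g₂
              (λ a b ab → cl-proper _ _ (trans (adj-right-right a b) ab) ∘ toℕ-injective)
      bounded : ∀ {k} (g : Fin k → Fin (m + n)) {x} → x ∈ map (toℕ ∘ cl ∘ g) (allFin k) → x < c
      bounded g x∈ with ∈-map⁻ (toℕ ∘ cl ∘ g) x∈
      ... | _ , _ , refl = toℕ<n _
      disjoint : ∀ {x} → x ∈ map g₁ (allFin m) → x ∈ map g₂ (allFin n) → ⊥
      disjoint x∈₁ x∈₂ with ∈-map⁻ g₁ x∈₁ | ∈-map⁻ g₂ x∈₂
      ... | a , _ , x≡ | b , _ , x≡′ = cl-proper _ _ (adj-left-right a b) (toℕ-injective (trans (sym x≡) x≡′))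

-- Semi-magic squares

record SemiMagicSquare (n : ℕ) : Set where
  field
    entry           : Fin n → Fin n → ℕ
    entry<n*n       : ∀ i j → entry i j < n * n
    entry-injective : ∀ {i j k l} → entry i j ≡ entry k l → i ≡ k × j ≡ l
    rowSum          : ℕ
    row-sum         : ∀ i → ∑[ j < n ] entry i j ≡ rowSum
    colSum          : ℕ
    col-sum         : ∀ j → ∑[ i < n ] entry i j ≡ colSum

  rowSum≡colSum : .{{NonZero n}} → rowSum ≡ colSum
  rowSum≡colSum = *-cancelˡ-≡ rowSum colSum n (begin
    n * rowSum                      ≡⟨ sym (∑-const n rowSum) ⟩
    ∑[ i < n ] rowSum               ≡⟨ sym (∑-cong n row-sum) ⟩
    ∑[ i < n ] ∑[ j < n ] entry i j ≡⟨ ∑-comm n n entry ⟩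
    ∑[ j < n ] ∑[ i < n ] entry i j ≡⟨ ∑-cong n col-sum ⟩
    ∑[ j < n ] colSum               ≡⟨ ∑-const n colSum ⟩
    n * colSum                      ∎)
    where open ≡-Reasoning

digits-injective : ∀ k {a b a′ b′} → b < k → b′ < k → k * a + b ≡ k * a′ + b′ → a ≡ a′ × b ≡ b′
digits-injective k {a} {b} {a′} {b′} b<k b′<k eq =
  *-cancelˡ-≡ a a′ k (+-cancelʳ-≡ _ _ _ (trans eq (cong (k * a′ +_) (sym b≡b′)))) , b≡b′
  where
  instance _ = >-nonZero (≤-<-trans z≤n b<k)
  low-digit : ∀ a b → b < k → (k * a + b) % k ≡ b
  low-digit a b b<k = trans (cong (_% k) (trans (+-comm (k * a) b) (cong (b +_) (*-comm k a))))
                            (trans ([m+kn]%n≡m%n b a k) (m<n⇒m%n≡m b<k))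
  b≡b′ = trans (sym (low-digit a b b<k)) (trans (cong (_% k) eq) (low-digit a′ b′ b′<k))

digits< : ∀ k {a b n} → a < n → b < k → k * a + b < k * n
digits< k {a} {b} {n} a<n b<k = begin-strict
  k * a + b   <⟨ +-monoʳ-< (k * a) b<k ⟩
  k * a + k   ≡⟨ trans (+-comm (k * a) k) (sym (*-suc k a)) ⟩
  k * suc a   ≤⟨ *-monoʳ-≤ k a<n ⟩
  k * n       ∎
  where open ≤-Reasoning

module Modular (N : ℕ) .{{_ : NonZero N}} where

  %-≡⇒∣∸ : ∀ a b → a % N ≡ b % N → N ∣ b ∸ a
  %-≡⇒∣∸ a b eq = divides (b / N ∸ a / N) (begin
    b ∸ a                                     ≡⟨ cong₂ _∸_ (m≡m%n+[m/n]*n b N) (m≡m%n+[m/n]*n a N) ⟩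
    (b % N + b / N * N) ∸ (a % N + a / N * N) ≡⟨ cong (λ r → (b % N + b / N * N) ∸ (r + a / N * N)) eq ⟩
    (b % N + b / N * N) ∸ (b % N + a / N * N) ≡⟨ [m+n]∸[m+o]≡n∸o (b % N) _ _ ⟩
    b / N * N ∸ a / N * N                     ≡⟨ sym (*-distribʳ-∸ N (b / N) (a / N)) ⟩
    (b / N ∸ a / N) * N                       ∎)
    where open ≡-Reasoning

  ∣∧<⇒≡0 : ∀ {d} → N ∣ d → d < N → d ≡ 0
  ∣∧<⇒≡0 {zero}  _   _   = refl
  ∣∧<⇒≡0 {suc d} N∣d d<N = contradiction N∣d (>⇒∤ d<N)

  +-%-injective : ∀ k {x y} → x < N → y < N → (k + x) % N ≡ (k + y) % N → x ≡ y
  +-%-injective k x<N y<N eq = ≤-antisym (cancel x<N (sym eq)) (cancel y<N eq)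
    where
    cancel : ∀ {x y} → y < N → (k + x) % N ≡ (k + y) % N → y ≤ x
    cancel {x} {y} y<N eq = m∸n≡0⇒m≤n (∣∧<⇒≡0 (subst (N ∣_) ([m+n]∸[m+o]≡n∸o k y x) (%-≡⇒∣∸ _ _ eq))
                                             (≤-<-trans (m∸n≤m y x) y<N))

  [m+n]%N≡[m%N+n]%N : ∀ a b → b < N → (a + b) % N ≡ (a % N + b) % N
  [m+n]%N≡[m%N+n]%N a b b<N = trans (%-distribˡ-+ a b N) (cong (λ r → (a % N + r) % N) (m<n⇒m%n≡m b<N))

module OddModular (m : ℕ) where
  N : ℕ
  N = suc (2 * m)
  open Modular N

  odd∣double⇒≡0 : ∀ {d} → N ∣ 2 * d → d < N → d ≡ 0
  odd∣double⇒≡0 {d} (divides zero          2d≡0)   _   = m+n≡0⇒m≡0 d 2d≡0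
  odd∣double⇒≡0 {d} (divides 1             2d≡N)   _   = contradiction (trans 2d≡N (+-identityʳ N)) (even≢odd d m)
  odd∣double⇒≡0 {d} (divides (suc (suc q)) 2d≡qN) d<N = contradiction (begin-strict
    2 * N           ≤⟨ *-monoˡ-≤ N {2} {suc (suc q)} (s≤s (s≤s z≤n)) ⟩
    suc (suc q) * N ≡⟨ sym 2d≡qN ⟩
    2 * d           <⟨ *-monoʳ-< 2 d<N ⟩
    2 * N           ∎) (<-irrefl refl)
    where open ≤-Reasoning

  +2*-%-injective : ∀ k {x y} → x < N → y < N → (k + 2 * x) % N ≡ (k + 2 * y) % N → x ≡ y
  +2*-%-injective k x<N y<N eq = ≤-antisym (cancel x<N (sym eq)) (cancel y<N eq)
    where
    cancel : ∀ {x y} → y < N → (k + 2 * x) % N ≡ (k + 2 * y) % N → y ≤ x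
    cancel {x} {y} y<N eq = m∸n≡0⇒m≤n (odd∣double⇒≡0
      (subst (N ∣_) (trans ([m+n]∸[m+o]≡n∸o k (2 * y) (2 * x)) (sym (*-distribˡ-∸ 2 y x)))
                    (%-≡⇒∣∸ (k + 2 * x) (k + 2 * y) eq))
      (≤-<-trans (m∸n≤m y x) y<N))

-- For odd N both digits of N · ((i + j) mod N) + ((i + 2j) mod N) run through all residues along
-- every row and column, because 1 and 2 are invertible modulo N.
module OddSquare (m : ℕ) where
  open OddModular m
  open Modular N

  high : Fin N → Fin N → ℕ
  high i j = (toℕ i + toℕ j) % N

  low : Fin N → Fin N → ℕ
  low i j = (toℕ i + 2 * toℕ j) % N

  entry : Fin N → Fin N → ℕ
  entry i j = N * high i j + low i j

  T : ℕ
  T = ∑[ i < N ] toℕ i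

  ∑-shift : ∀ k → ∑[ j < N ] ((k + toℕ j) % N) ≡ T
  ∑-shift k = ∑-reindex N (λ x → (k + x) % N) (λ {x} _ → m%n<n (k + x) N) (+-%-injective k)

  ∑-shift-double : ∀ k → ∑[ j < N ] ((k + 2 * toℕ j) % N) ≡ T
  ∑-shift-double k = ∑-reindex N (λ x → (k + 2 * x) % N) (λ {x} _ → m%n<n (k + 2 * x) N) (+2*-%-injective k)

  ∑-digits : ∀ (f g : Fin N → ℕ) → ∑[ i < N ] f i ≡ T → ∑[ i < N ] g i ≡ T →
             ∑[ i < N ] (N * f i + g i) ≡ N * T + T
  ∑-digits f g ∑f ∑g = trans (∑-distrib-+ N (λ i → N * f i) g)
                             (cong₂ _+_ (trans (∑-distribˡ-* N N f) (cong (N *_) ∑f)) ∑g)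

  low≡ : ∀ i j → low i j ≡ (high i j + toℕ j) % N
  low≡ i j = trans (cong (λ r → (toℕ i + r) % N) (cong (toℕ j +_) (+-identityʳ (toℕ j))))
    (trans (cong (_% N) (sym (+-assoc (toℕ i) (toℕ j) (toℕ j))))
           ([m+n]%N≡[m%N+n]%N (toℕ i + toℕ j) (toℕ j) (toℕ<n j)))

  entry-injective : ∀ {i j k l} → entry i j ≡ entry k l → i ≡ k × j ≡ l
  entry-injective {i} {j} {k} {l} eq = i≡k , j≡l
    where
    digits = digits-injective N (m%n<n (toℕ i + 2 * toℕ j) N) (m%n<n (toℕ k + 2 * toℕ l) N) eq
    j≡l : j ≡ l
    j≡l = toℕ-injective (+-%-injective (high i j) (toℕ<n j) (toℕ<n l) (begin
      (high i j + toℕ j) % N ≡⟨ sym (low≡ i j) ⟩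
      low i j                 ≡⟨ proj₂ digits ⟩
      low k l                 ≡⟨ low≡ k l ⟩
      (high k l + toℕ l) % N ≡⟨ cong (λ d → (d + toℕ l) % N) (sym (proj₁ digits)) ⟩
      (high i j + toℕ l) % N ∎))
      where open ≡-Reasoning
    i≡k : i ≡ k
    i≡k = toℕ-injective (+-%-injective (toℕ j) (toℕ<n i) (toℕ<n k) (begin
      (toℕ j + toℕ i) % N ≡⟨ cong (_% N) (+-comm (toℕ j) (toℕ i)) ⟩
      high i j        ≡⟨ proj₁ digits ⟩
      high k l        ≡⟨ cong (λ j → (toℕ k + toℕ j) % N) (sym j≡l) ⟩
      (toℕ k + toℕ j) % N ≡⟨ cong (_% N) (+-comm (toℕ k) (toℕ j)) ⟩
      (toℕ j + toℕ k) % N ∎))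
      where open ≡-Reasoning

  square : SemiMagicSquare N
  square = record
    { entry           = entry
    ; entry<n*n       = λ i j → digits< N (m%n<n (toℕ i + toℕ j) N) (m%n<n (toℕ i + 2 * toℕ j) N)
    ; entry-injective = entry-injective
    ; rowSum          = N * T + T
    ; row-sum         = λ i → ∑-digits (high i) (low i) (∑-shift (toℕ i)) (∑-shift-double (toℕ i))
    ; colSum          = N * T + T
    ; col-sum         = λ j → ∑-digits (λ i → high i j) (λ i → low i j)
        (trans (∑-cong N (λ i → cong (_% N) (+-comm (toℕ i) (toℕ j)))) (∑-shift (toℕ j)))
        (trans (∑-cong N (λ i → cong (_% N) (+-comm (toℕ i) (2 * toℕ j)))) (∑-shift (2 * toℕ j)))
    }

square4 : SemiMagicSquare 4
square4 = record
  { entry           = entry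
  ; entry<n*n       = toWitness {a? = all? λ i → all? λ j → entry i j <? 16} _
  ; entry-injective = λ {i} {j} {k} {l} → toWitness {a? = injective?} _ i j k l
  ; rowSum          = 30
  ; row-sum         = toWitness {a? = all? λ i → ∑[ j < 4 ] entry i j ≟ 30} _
  ; colSum          = 30
  ; col-sum         = toWitness {a? = all? λ j → ∑[ i < 4 ] entry i j ≟ 30} _
  }
  where
  table : Vec (Vec ℕ 4) 4
  table = (15 ∷ 2  ∷ 1  ∷ 12 ∷ []) ∷
          (4  ∷ 9  ∷ 10 ∷ 7  ∷ []) ∷
          (8  ∷ 5  ∷ 6  ∷ 11 ∷ []) ∷
          (3  ∷ 14 ∷ 13 ∷ 0  ∷ []) ∷ []
  entry : Fin 4 → Fin 4 → ℕ
  entry i j = Vec.lookup (Vec.lookup table i) j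
  injective? : Dec (∀ i j k l → entry i j ≡ entry k l → i ≡ k × j ≡ l)
  injective? = all? λ i → all? λ j → all? λ k → all? λ l →
               (entry i j ≟ entry k l) →-dec ((i Fin.≟ k) ×-dec (j Fin.≟ l))

-- A block Bₛₜ is a 2 × 2 arrangement of 0, 1, 2, 3 with both column sums 3 and row sums s and t.
data Block : Set where
  B₄₂ B₂₄ B₁₅ : Block

blockTable : Block → Vec (Vec ℕ 2) 2
blockTable B₄₂ = (3 ∷ 1 ∷ []) ∷ (0 ∷ 2 ∷ []) ∷ []
blockTable B₂₄ = (0 ∷ 2 ∷ []) ∷ (3 ∷ 1 ∷ []) ∷ []
blockTable B₁₅ = (0 ∷ 1 ∷ []) ∷ (3 ∷ 2 ∷ []) ∷ []

blockEntry : Block → Fin 2 → Fin 2 → ℕ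
blockEntry b x y = Vec.lookup (Vec.lookup (blockTable b) x) y

blockEntry<4 : ∀ b x y → blockEntry b x y < 4
blockEntry<4 B₄₂ = toWitness {a? = all? λ x → all? λ y → blockEntry B₄₂ x y <? 4} _
blockEntry<4 B₂₄ = toWitness {a? = all? λ x → all? λ y → blockEntry B₂₄ x y <? 4} _
blockEntry<4 B₁₅ = toWitness {a? = all? λ x → all? λ y → blockEntry B₁₅ x y <? 4} _

blockEntry-injective : ∀ b {x y x′ y′} → blockEntry b x y ≡ blockEntry b x′ y′ → x ≡ x′ × y ≡ y′
blockEntry-injective b {x} {y} {x′} {y′} = injective b x y x′ y′
  where
  injective? : ∀ b → Dec (∀ x y x′ y′ → blockEntry b x y ≡ blockEntry b x′ y′ → x ≡ x′ × y ≡ y′)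
  injective? b = all? λ x → all? λ y → all? λ x′ → all? λ y′ →
                 (blockEntry b x y ≟ blockEntry b x′ y′) →-dec ((x Fin.≟ x′) ×-dec (y Fin.≟ y′))
  injective : ∀ b x y x′ y′ → blockEntry b x y ≡ blockEntry b x′ y′ → x ≡ x′ × y ≡ y′
  injective B₄₂ = toWitness {a? = injective? B₄₂} _
  injective B₂₄ = toWitness {a? = injective? B₂₄} _
  injective B₁₅ = toWitness {a? = injective? B₁₅} _

blockEntry-column-sum : ∀ b y → blockEntry b zero y + blockEntry b (suc zero) y ≡ 3
blockEntry-column-sum B₄₂ = toWitness {a? = all? λ y → blockEntry B₄₂ zero y + blockEntry B₄₂ (suc zero) y ≟ 3} _
blockEntry-column-sum B₂₄ = toWitness {a? = all? λ y → blockEntry B₂₄ zero y + blockEntry B₂₄ (suc zero) y ≟ 3} _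
blockEntry-column-sum B₁₅ = toWitness {a? = all? λ y → blockEntry B₁₅ zero y + blockEntry B₁₅ (suc zero) y ≟ 3} _

blockRowSum : Block → Fin 2 → ℕ
blockRowSum b x = blockEntry b x zero + blockEntry b x (suc zero)

blockPattern : ∀ k → Fin (2 + k) → Block
blockPattern zero          zero             = B₄₂
blockPattern zero          (suc zero)       = B₂₄
blockPattern (suc zero)    zero             = B₄₂
blockPattern (suc zero)    (suc zero)       = B₄₂
blockPattern (suc zero)    (suc (suc zero)) = B₁₅
blockPattern (suc (suc k)) zero             = B₄₂
blockPattern (suc (suc k)) (suc zero)       = B₂₄
blockPattern (suc (suc k)) (suc (suc j))    = blockPattern k j

blockPattern-row-sum : ∀ k x → ∑[ j < 2 + k ] blockRowSum (blockPattern k j) x ≡ (2 + k) * 3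
blockPattern-row-sum zero          zero       = refl
blockPattern-row-sum zero          (suc zero) = refl
blockPattern-row-sum (suc zero)    zero       = refl
blockPattern-row-sum (suc zero)    (suc zero) = refl
blockPattern-row-sum (suc (suc k)) x =
  trans (sym (+-assoc (blockRowSum B₄₂ x) (blockRowSum B₂₄ x) _))
        (cong₂ _+_ (B₄₂+B₂₄ x) (blockPattern-row-sum k x))
  where
  B₄₂+B₂₄ : ∀ x → blockRowSum B₄₂ x + blockRowSum B₂₄ x ≡ 6
  B₄₂+B₂₄ zero       = refl
  B₄₂+B₂₄ (suc zero) = refl

-- Each entry e in column j of a square of order m = 2 + k becomes the 2 × 2 block 4e + B, with
-- B = blockPattern k j; the chosen blocks make the rows of the new square of order 2m balance.
module Doubling {k : ℕ} (S : SemiMagicSquare (2 + k)) where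
  open SemiMagicSquare S

  m : ℕ
  m = 2 + k

  half : Fin (m + m) → Fin 2 × Fin m
  half x = [ (zero ,_) , (suc zero ,_) ]′ (splitAt m x)

  half-left : ∀ a → half (a ↑ˡ m) ≡ (zero , a)
  half-left a rewrite splitAt-↑ˡ m a m = refl

  half-right : ∀ b → half (m ↑ʳ b) ≡ (suc zero , b)
  half-right b rewrite splitAt-↑ʳ m m b = refl

  unhalf : Fin 2 × Fin m → Fin (m + m)
  unhalf (zero     , a) = a ↑ˡ m
  unhalf (suc zero , b) = m ↑ʳ b

  unhalf-half : ∀ x → unhalf (half x) ≡ x
  unhalf-half x with joinView m m x
  ... | left  a = cong unhalf (half-left a)
  ... | right b = cong unhalf (half-right b)

  half-injective : ∀ {x y} → half x ≡ half y → x ≡ y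
  half-injective {x} {y} eq = trans (sym (unhalf-half x)) (trans (cong unhalf eq) (unhalf-half y))

  ∑-halves : (f : Fin 2 × Fin m → ℕ) →
             ∑[ x < m + m ] f (half x) ≡ ∑[ j < m ] f (zero , j) + ∑[ j < m ] f (suc zero , j)
  ∑-halves f = trans (∑-++ m m (f ∘ half))
                     (cong₂ _+_ (∑-cong m (cong f ∘ half-left)) (∑-cong m (cong f ∘ half-right)))

  ∑-two-lines : ∀ (f g h : Fin m → ℕ) → ∑[ j < m ] (f j + g j) + ∑[ j < m ] (f j + h j) ≡
                (∑[ j < m ] f j + ∑[ j < m ] f j) + ∑[ j < m ] (g j + h j)
  ∑-two-lines f g h = trans (cong₂ _+_ (∑-distrib-+ m f g) (∑-distrib-+ m f h))
                            (trans (interchange (∑[ j < m ] f j) (∑[ j < m ] g j) (∑[ j < m ] f j) (∑[ j < m ] h j))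
                                   (cong (∑[ j < m ] f j + ∑[ j < m ] f j +_) (sym (∑-distrib-+ m g h))))

  blocked : Fin 2 × Fin m → Fin 2 × Fin m → ℕ
  blocked (x , i) (y , j) = 4 * entry i j + blockEntry (blockPattern k j) x y

  blocked-injective : ∀ {p q p′ q′} → blocked p q ≡ blocked p′ q′ → p ≡ p′ × q ≡ q′
  blocked-injective {x , i} {y , j} {x′ , i′} {y′ , j′} eq
    with digits-injective 4 (blockEntry<4 (blockPattern k j) x y) (blockEntry<4 (blockPattern k j′) x′ y′) eq
  ... | entries≡ , blocks≡ with entry-injective entries≡
  ... | refl , refl with blockEntry-injective (blockPattern k j) {x} {y} {x′} {y′} blocks≡
  ... | refl , refl = refl , refl

  row-sum′ : ∀ a → ∑[ b < m + m ] blocked (half a) (half b) ≡ (4 * rowSum + 4 * rowSum) + m * 3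
  row-sum′ a with half a
  ... | x , i = begin
    ∑[ b < m + m ] blocked (x , i) (half b)
      ≡⟨ ∑-halves (blocked (x , i)) ⟩
    ∑[ j < m ] (4 * entry i j + blockEntry (blockPattern k j) x zero) +
    ∑[ j < m ] (4 * entry i j + blockEntry (blockPattern k j) x (suc zero))
      ≡⟨ ∑-two-lines (λ j → 4 * entry i j) (λ j → blockEntry (blockPattern k j) x zero)
                     (λ j → blockEntry (blockPattern k j) x (suc zero)) ⟩
    (∑[ j < m ] (4 * entry i j) + ∑[ j < m ] (4 * entry i j)) + ∑[ j < m ] blockRowSum (blockPattern k j) x
      ≡⟨ cong₂ _+_ (cong₂ _+_ ∑4*entry ∑4*entry) (blockPattern-row-sum k x) ⟩
    (4 * rowSum + 4 * rowSum) + m * 3 ∎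
    where
    open ≡-Reasoning
    ∑4*entry = trans (∑-distribˡ-* m 4 (entry i)) (cong (4 *_) (row-sum i))

  col-sum′ : ∀ b → ∑[ a < m + m ] blocked (half a) (half b) ≡ (4 * colSum + 4 * colSum) + m * 3
  col-sum′ b with half b
  ... | y , j = begin
    ∑[ a < m + m ] blocked (half a) (y , j)
      ≡⟨ ∑-halves (λ p → blocked p (y , j)) ⟩
    ∑[ i < m ] (4 * entry i j + blockEntry (blockPattern k j) zero y) +
    ∑[ i < m ] (4 * entry i j + blockEntry (blockPattern k j) (suc zero) y)
      ≡⟨ ∑-two-lines (λ i → 4 * entry i j) (λ _ → blockEntry (blockPattern k j) zero y)
                     (λ _ → blockEntry (blockPattern k j) (suc zero) y) ⟩
    (∑[ i < m ] (4 * entry i j) + ∑[ i < m ] (4 * entry i j)) +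
    ∑[ i < m ] (blockEntry (blockPattern k j) zero y + blockEntry (blockPattern k j) (suc zero) y)
      ≡⟨ cong₂ _+_ (cong₂ _+_ ∑4*entry ∑4*entry)
                   (trans (∑-cong m (λ _ → blockEntry-column-sum (blockPattern k j) y)) (∑-const m 3)) ⟩
    (4 * colSum + 4 * colSum) + m * 3 ∎
    where
    open ≡-Reasoning
    ∑4*entry = trans (∑-distribˡ-* m 4 (λ i → entry i j)) (cong (4 *_) (col-sum j))

  blocked< : ∀ p q → blocked p q < 4 * (m * m)
  blocked< (x , i) (y , j) = digits< 4 (entry<n*n i j) (blockEntry<4 (blockPattern k j) x y)

  [m+m]*[m+m]≡4*[m*m] : (m + m) * (m + m) ≡ 4 * (m * m)
  [m+m]*[m+m]≡4*[m*m] = solve 1 (λ m → (m :+ m) :* (m :+ m) := con 4 :* (m :* m)) refl m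
    where open +-*-Solver

  square : SemiMagicSquare (m + m)
  square = record
    { entry           = λ a b → blocked (half a) (half b)
    ; entry<n*n       = λ a b → subst (blocked (half a) (half b) <_) (sym [m+m]*[m+m]≡4*[m*m]) (blocked< (half a) (half b))
    ; entry-injective = λ eq → let p≡p′ , q≡q′ = blocked-injective eq in half-injective p≡p′ , half-injective q≡q′
    ; rowSum          = (4 * rowSum + 4 * rowSum) + m * 3
    ; row-sum         = row-sum′
    ; colSum          = (4 * colSum + 4 * colSum) + m * 3
    ; col-sum         = col-sum′
    }

emptySquare : SemiMagicSquare 0
emptySquare = record
  { entry = λ () ; entry<n*n = λ () ; entry-injective = λ { {()} }
  ; rowSum = 0 ; row-sum = λ () ; colSum = 0 ; col-sum = λ () }

parity : ∀ n → ∃ λ h → n ≡ 2 * h ⊎ n ≡ suc (2 * h)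
parity zero = 0 , inj₁ refl
parity (suc n) with parity n
... | h , inj₁ n≡2h  = h , inj₂ (cong suc n≡2h)
... | h , inj₂ n≡1+2h = suc h , inj₁ (trans (cong suc n≡1+2h) (sym (*-suc 2 h)))

semiMagicSquare : ∀ n → n ≢ 2 → SemiMagicSquare n
semiMagicSquare = <-rec (λ n → n ≢ 2 → SemiMagicSquare n) step
  where
  step : ∀ n → (∀ {h} → h < n → h ≢ 2 → SemiMagicSquare h) → n ≢ 2 → SemiMagicSquare n
  step n rec n≢2 with parity n
  ... | h                     , inj₂ refl = OddSquare.square h
  ... | zero                  , inj₁ refl = emptySquare
  ... | suc zero              , inj₁ refl = contradiction refl n≢2
  ... | suc (suc zero)        , inj₁ refl = square4
  ... | h@(suc (suc (suc k))) , inj₁ refl =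
    subst SemiMagicSquare (cong (h +_) (sym (+-identityʳ h))) (Doubling.square (rec (m<m+n h z<s) λ ()))

-- A local antimagic labeling of G ∨ G

≤⇒≢+suc : ∀ {a} k {b} → a ≤ k → a ≢ k + suc b
≤⇒≢+suc k a≤k refl = m+1+n≰m k a≤k

module JoinLabeling {p : ℕ} (G : Graph p) (π : EdgeLabeling G) (S : SemiMagicSquare p) where
  open LabelWeight G π
  open SemiMagicSquare S
  open Join G G
  open EdgeList (G ∨ᴳ G) using (edges-isEdge)

  q s : ℕ
  q = size G
  s = q + p * p

  joinWeight : Fin (p + p) × Fin (p + p) → ℕ
  joinWeight (x , y) with splitAt p x | splitAt p y
  ... | inj₁ a | inj₁ b = weight (a , b)
  ... | inj₁ a | inj₂ b = q + suc (entry a b)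
  ... | inj₂ a | inj₁ b = q + suc (entry b a)
  ... | inj₂ a | inj₂ b = s + weight (a , b)

  joinWeight-left-left : ∀ a b → joinWeight (a ↑ˡ p , b ↑ˡ p) ≡ weight (a , b)
  joinWeight-left-left a b rewrite splitAt-↑ˡ p a p | splitAt-↑ˡ p b p = refl

  joinWeight-left-right : ∀ a b → joinWeight (a ↑ˡ p , p ↑ʳ b) ≡ q + suc (entry a b)
  joinWeight-left-right a b rewrite splitAt-↑ˡ p a p | splitAt-↑ʳ p p b = refl

  joinWeight-right-left : ∀ b a → joinWeight (p ↑ʳ b , a ↑ˡ p) ≡ q + suc (entry a b)
  joinWeight-right-left b a rewrite splitAt-↑ˡ p a p | splitAt-↑ʳ p p b = refl

  joinWeight-right-right : ∀ a b → joinWeight (p ↑ʳ a , p ↑ʳ b) ≡ s + weight (a , b)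
  joinWeight-right-right a b rewrite splitAt-↑ʳ p p a | splitAt-↑ʳ p p b = refl

  joinWeight-sym : ∀ x y → joinWeight (x , y) ≡ joinWeight (y , x)
  joinWeight-sym x y with splitAt p x | splitAt p y
  ... | inj₁ a | inj₁ b = weight-sym a b
  ... | inj₁ a | inj₂ b = refl
  ... | inj₂ a | inj₁ b = refl
  ... | inj₂ a | inj₂ b = cong (s +_) (weight-sym a b)

  data JoinEdge : Fin (p + p) × Fin (p + p) → Set where
    inner-left  : ∀ {a b} → (a , b) ∈ edges G → JoinEdge (a ↑ˡ p , b ↑ˡ p)
    across      : ∀ a b → JoinEdge (a ↑ˡ p , p ↑ʳ b)
    inner-right : ∀ {a b} → (a , b) ∈ edges G → JoinEdge (p ↑ʳ a , p ↑ʳ b)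

  joinEdge : ∀ {x} → x ∈ edges (G ∨ᴳ G) → JoinEdge x
  joinEdge {x , y} x∈ with joinView p p x | joinView p p y | All.lookup edges-isEdge x∈
  ... | left  a | left  b | xy = inner-left (G.∈-edges (trans (sym (isEdge-left-left a b)) xy))
  ... | left  a | right b | _  = across a b
  ... | right a | left  b | xy = contradiction (trans (sym (isEdge-right-left a b)) xy) λ ()
  ... | right a | right b | xy = inner-right (G.∈-edges (trans (sym (isEdge-right-right a b)) xy))

  joinWeight-range : ∀ {x} → JoinEdge x → ∃ λ t → joinWeight x ≡ suc t × t < s + q
  joinWeight-range (inner-left {a} {b} ab∈) with weight-∈ ab∈
  ... | t , w≡ , t<q = t , trans (joinWeight-left-left a b) w≡ , <-≤-trans t<q (m≤n+m q s)
  joinWeight-range (across a b) =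
    q + entry a b , trans (joinWeight-left-right a b) (+-suc q _) ,
    <-≤-trans (+-monoʳ-< q (entry<n*n a b)) (m≤m+n s q)
  joinWeight-range (inner-right {a} {b} ab∈) with weight-∈ ab∈
  ... | t , w≡ , t<q = s + t , trans (joinWeight-right-right a b) (trans (cong (s +_) w≡) (+-suc s t)) ,
                       +-monoʳ-< s t<q

  left-below : ∀ {a b} → (a , b) ∈ edges G → joinWeight (a ↑ˡ p , b ↑ˡ p) ≤ q
  left-below {a} {b} ab∈ with weight-∈ ab∈
  ... | t , w≡ , t<q = subst (_≤ q) (sym (trans (joinWeight-left-left a b) w≡)) t<q

  across-below : ∀ a b → joinWeight (a ↑ˡ p , p ↑ʳ b) ≤ s
  across-below a b = subst (_≤ s) (sym (joinWeight-left-right a b)) (+-monoʳ-≤ q (entry<n*n a b))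

  right-above : ∀ {a b} → (a , b) ∈ edges G → ∃ λ t → joinWeight (p ↑ʳ a , p ↑ʳ b) ≡ s + suc t
  right-above {a} {b} ab∈ with weight-∈ ab∈
  ... | t , w≡ , _ = t , trans (joinWeight-right-right a b) (cong (s +_) w≡)

  joinWeight-injective : ∀ {x y} → JoinEdge x → JoinEdge y → joinWeight x ≡ joinWeight y → x ≡ y
  joinWeight-injective (inner-left {a} {b} ab∈) (inner-left {a′} {b′} ab∈′) eq
    with weight-injective ab∈ ab∈′ (trans (sym (joinWeight-left-left a b)) (trans eq (joinWeight-left-left a′ b′)))
  ... | refl = refl
  joinWeight-injective (across a b) (across a′ b′) eq
    with entry-injective (suc-injective (+-cancelˡ-≡ q _ _
           (trans (sym (joinWeight-left-right a b)) (trans eq (joinWeight-left-right a′ b′)))))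
  ... | refl , refl = refl
  joinWeight-injective (inner-right {a} {b} ab∈) (inner-right {a′} {b′} ab∈′) eq
    with weight-injective ab∈ ab∈′ (+-cancelˡ-≡ s _ _
           (trans (sym (joinWeight-right-right a b)) (trans eq (joinWeight-right-right a′ b′))))
  ... | refl = refl
  joinWeight-injective (inner-left ab∈) (across a′ b′) eq =
    contradiction (trans eq (joinWeight-left-right a′ b′)) (≤⇒≢+suc q (left-below ab∈))
  joinWeight-injective (across a b) (inner-left ab∈′) eq =
    contradiction (trans (sym eq) (joinWeight-left-right a b)) (≤⇒≢+suc q (left-below ab∈′))
  joinWeight-injective (inner-left ab∈) (inner-right ab∈′) eq with right-above ab∈′
  ... | _ , w≡ = contradiction (trans eq w≡) (≤⇒≢+suc s (≤-trans (left-below ab∈) (m≤m+n q (p * p))))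
  joinWeight-injective (inner-right ab∈) (inner-left ab∈′) eq with right-above ab∈
  ... | _ , w≡ = contradiction (trans (sym eq) w≡) (≤⇒≢+suc s (≤-trans (left-below ab∈′) (m≤m+n q (p * p))))
  joinWeight-injective (across a b) (inner-right ab∈′) eq with right-above ab∈′
  ... | _ , w≡ = contradiction (trans eq w≡) (≤⇒≢+suc s (across-below a b))
  joinWeight-injective (inner-right ab∈) (across a′ b′) eq with right-above ab∈
  ... | _ , w≡ = contradiction (trans (sym eq) w≡) (≤⇒≢+suc s (across-below a′ b′))

  opaque
    labeling : Σ (EdgeLabeling (G ∨ᴳ G)) λ π′ →
               ∀ e → label (G ∨ᴳ G) π′ e ≡ joinWeight (lookup (edges (G ∨ᴳ G)) e)
    labeling = labeling-from-weight (G ∨ᴳ G) joinWeight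
      (λ x∈ → let t , w≡ , t< = joinWeight-range (joinEdge x∈) in t , w≡ , subst (t <_) (sym size-join) t<)
      (λ x∈ y∈ → joinWeight-injective (joinEdge x∈) (joinEdge y∈))

  π′ : EdgeLabeling (G ∨ᴳ G)
  π′ = proj₁ labeling

  vertexSum′≡∑ : ∀ u → vertexSum (G ∨ᴳ G) π′ u ≡ ∑[ v < p + p ] (joinWeight (u , v) when adj (G ∨ᴳ G) u v)
  vertexSum′≡∑ = vertexSum-by-weight (G ∨ᴳ G) π′ joinWeight joinWeight-sym (proj₂ labeling)

  C : ℕ
  C = p * suc q + rowSum

  ∑-across : ∀ (f : Fin p → ℕ) {c} → ∑[ b < p ] f b ≡ c → ∑[ b < p ] (q + suc (f b)) ≡ p * suc q + c
  ∑-across f ∑f = trans (∑-cong p (λ b → +-suc q (f b)))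
                        (trans (∑-distrib-+ p (λ _ → suc q) f) (cong₂ _+_ (∑-const p (suc q)) ∑f))

  vertexSum-left : ∀ a → vertexSum (G ∨ᴳ G) π′ (a ↑ˡ p) ≡ vertexSum G π a + C
  vertexSum-left a = begin
    vertexSum (G ∨ᴳ G) π′ (a ↑ˡ p)
      ≡⟨ trans (vertexSum′≡∑ _) (∑-++ p p (λ v → joinWeight (a ↑ˡ p , v) when adj (G ∨ᴳ G) (a ↑ˡ p) v)) ⟩
    ∑[ b < p ] (joinWeight (a ↑ˡ p , b ↑ˡ p) when adj (G ∨ᴳ G) (a ↑ˡ p) (b ↑ˡ p)) +
    ∑[ b < p ] (joinWeight (a ↑ˡ p , p ↑ʳ b) when adj (G ∨ᴳ G) (a ↑ˡ p) (p ↑ʳ b))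
      ≡⟨ cong₂ _+_ (∑-cong p λ b → cong₂ _when_ (joinWeight-left-left a b) (adj-left-left a b))
                   (∑-cong p λ b → cong₂ _when_ (joinWeight-left-right a b) (adj-left-right a b)) ⟩
    ∑[ b < p ] (weight (a , b) when adj G a b) + ∑[ b < p ] (q + suc (entry a b))
      ≡⟨ cong₂ _+_ (sym (vertexSum≡∑weight a)) (∑-across (entry a) (row-sum a)) ⟩
    vertexSum G π a + C ∎
    where open ≡-Reasoning

  vertexSum-right : ∀ a → vertexSum (G ∨ᴳ G) π′ (p ↑ʳ a) ≡ (degree G a * s + vertexSum G π a) + C
  vertexSum-right a = begin
    vertexSum (G ∨ᴳ G) π′ (p ↑ʳ a)
      ≡⟨ trans (vertexSum′≡∑ _) (∑-++ p p (λ v → joinWeight (p ↑ʳ a , v) when adj (G ∨ᴳ G) (p ↑ʳ a) v)) ⟩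
    ∑[ b < p ] (joinWeight (p ↑ʳ a , b ↑ˡ p) when adj (G ∨ᴳ G) (p ↑ʳ a) (b ↑ˡ p)) +
    ∑[ b < p ] (joinWeight (p ↑ʳ a , p ↑ʳ b) when adj (G ∨ᴳ G) (p ↑ʳ a) (p ↑ʳ b))
      ≡⟨ cong₂ _+_ (∑-cong p λ b → cong₂ _when_ (joinWeight-right-left a b) (adj-right-left a b))
                   (∑-cong p λ b → trans (cong₂ _when_ (joinWeight-right-right a b) (adj-right-right a b))
                                         (when-distrib-+ s (weight (a , b)) (adj G a b))) ⟩
    ∑[ b < p ] (q + suc (entry b a)) + ∑[ b < p ] ((s when adj G a b) + (weight (a , b) when adj G a b))
      ≡⟨ cong₂ _+_ (∑-across (λ b → entry b a) (trans (col-sum a) (sym rowSum≡colSum)))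
                   (∑-distrib-+ p (λ b → s when adj G a b) (λ b → weight (a , b) when adj G a b)) ⟩
    C + (∑[ b < p ] (s when adj G a b) + ∑[ b < p ] (weight (a , b) when adj G a b))
      ≡⟨ cong (C +_) (cong₂ _+_ (trans (∑-when-scale p (adj G a) s) (cong (_* s) (sym (degree≡∑ G a))))
                                (sym (vertexSum≡∑weight a))) ⟩
    C + (degree G a * s + vertexSum G π a)
      ≡⟨ +-comm C _ ⟩
    (degree G a * s + vertexSum G π a) + C ∎
    where
    open ≡-Reasoning
    instance _ = >-nonZero (≤-<-trans z≤n (toℕ<n a))

  module _ {r} (1≤r : 1 ≤ r) (regular : Regular G r) (antimagic : IsLocalAntimagic G π) where

    vertexSum-right′ : ∀ a → vertexSum (G ∨ᴳ G) π′ (p ↑ʳ a) ≡ (r * s + vertexSum G π a) + C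
    vertexSum-right′ a = trans (vertexSum-right a) (cong (λ d → (d * s + vertexSum G π a) + C) (regular a))

    left<right-sum : ∀ a b → vertexSum G π a < r * s + vertexSum G π b
    left<right-sum a b = begin-strict
      vertexSum G π a     ≤⟨ vertexSum≤degree*size a ⟩
      degree G a * q      ≡⟨ cong (_* q) (regular a) ⟩
      r * q               ≤⟨ *-monoʳ-≤ r (m≤m+n q (p * p)) ⟩
      r * s               <⟨ m<m+n (r * s) (≤-trans 1≤r (subst (_≤ vertexSum G π b) (regular b) (degree≤vertexSum b))) ⟩
      r * s + vertexSum G π b ∎
      where open ≤-Reasoning

    left≢right : ∀ a b → vertexSum (G ∨ᴳ G) π′ (a ↑ˡ p) ≢ vertexSum (G ∨ᴳ G) π′ (p ↑ʳ b)
    left≢right a b eq = <-irrefl (+-cancelʳ-≡ C _ _ (trans (sym (vertexSum-left a)) (trans eq (vertexSum-right′ b))))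
                                 (left<right-sum a b)

    isLocalAntimagic′ : IsLocalAntimagic (G ∨ᴳ G) π′
    isLocalAntimagic′ x y xy with joinView p p x | joinView p p y
    ... | left  a | left  b = antimagic a b (trans (sym (adj-left-left a b)) xy) ∘ +-cancelʳ-≡ C _ _
                                ∘ λ eq → trans (sym (vertexSum-left a)) (trans eq (vertexSum-left b))
    ... | left  a | right b = left≢right a b
    ... | right a | left  b = left≢right b a ∘ sym
    ... | right a | right b = antimagic a b (trans (sym (adj-right-right a b)) xy) ∘ +-cancelˡ-≡ (r * s) _ _
                                ∘ +-cancelʳ-≡ C _ _
                                ∘ λ eq → trans (sym (vertexSum-right′ a)) (trans eq (vertexSum-right′ b))

    numColors′≤ : numColors (G ∨ᴳ G) π′ ≤ numColors G π + numColors G π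
    numColors′≤ = subst (numColors (G ∨ᴳ G) π′ ≤_)
      (trans (length-++ (map (_+ C) D)) (cong₂ _+_ (length-map (_+ C) D) (length-map shifted D)))
      (numDistinct≤ values⊆)
      where
      D = deduplicate _≟_ (map (vertexSum G π) (allFin p))
      shifted : ℕ → ℕ
      shifted v = (r * s + v) + C
      ∈D : ∀ a → vertexSum G π a ∈ D
      ∈D a = ∈-deduplicate⁺ _≟_ (∈-map⁺ (vertexSum G π) (∈-allFin a))
      values⊆ : ∀ {z} → z ∈ map (vertexSum (G ∨ᴳ G) π′) (allFin (p + p)) → z ∈ map (_+ C) D ++ map shifted D
      values⊆ z∈ with ∈-map⁻ (vertexSum (G ∨ᴳ G) π′) z∈
      ... | x , _ , refl with joinView p p x
      ...   | left  a = subst (_∈ map (_+ C) D ++ map shifted D) (sym (vertexSum-left a))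
                              (∈-++⁺ˡ (∈-map⁺ (_+ C) (∈D a)))
      ...   | right b = subst (_∈ map (_+ C) D ++ map shifted D) (sym (vertexSum-right′ b))
                              (∈-++⁺ʳ (map (_+ C) D) (∈-map⁺ shifted (∈D b)))

join-isLocalAntimagicChromaticNumber : ∀ {p r χ} {G : Graph p} → 1 ≤ r → Regular G r → SemiMagicSquare p →
  IsChromaticNumber G χ → IsLocalAntimagicChromaticNumber G χ → IsLocalAntimagicChromaticNumber (G ∨ᴳ G) (χ + χ)
join-isLocalAntimagicChromaticNumber {G = G} 1≤r regular S isχ ((π , antimagic , numColors≡χ) , _) =
  (π′ , antimagic′ , ≤-antisym upper (lower π′ antimagic′)) , lower
  where
  open JoinLabeling G π S using (π′; isLocalAntimagic′; numColors′≤)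
  antimagic′ = isLocalAntimagic′ 1≤r regular antimagic
  lower = chromaticNumber≤numColors {X = G ∨ᴳ G} (Join.isChromaticNumber-join G G isχ isχ)
  upper = subst (λ c → numColors (G ∨ᴳ G) π′ ≤ c + c) numColors≡χ (numColors′≤ 1≤r regular antimagic)

-- Iterated joins

regular-join : ∀ {p r} {G : Graph p} → Regular G r → Regular (G ∨ᴳ G) (r + p)
regular-join {p} {G = G} regular x with joinView p p x
... | left  a = trans (Join.degree-left G G a) (cong (_+ p) (regular a))
... | right b = trans (Join.degree-right G G b) (cong (_+ p) (regular b))

degree≤1 : (G : Graph 2) → degree G zero ≤ 1
degree≤1 G rewrite Graph.irrefl G zero with adj G zero (suc zero)
... | true  = s≤s z≤n
... | false = z≤n

regular⇒order≢2 : ∀ {p r} (G : Graph p) → 2 ≤ r → Regular G r → p ≢ 2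
regular⇒order≢2 G 2≤r regular refl = <⇒≱ 2≤r (subst (_≤ 1) (regular zero) (degree≤1 G))

join-step : ∀ {p r χ} (G : Graph p) → 2 ≤ r → Regular G r →
  IsLocalAntimagicChromaticNumber G χ → IsChromaticNumber G χ →
  Regular (G ∨ᴳ G) (r + p) × IsLocalAntimagicChromaticNumber (G ∨ᴳ G) (χ + χ) × IsChromaticNumber (G ∨ᴳ G) (χ + χ)
join-step {p} G 2≤r regular isχla isχ =
  regular-join regular ,
  join-isLocalAntimagicChromaticNumber (<⇒≤ 2≤r) regular (semiMagicSquare p (regular⇒order≢2 G 2≤r regular)) isχ isχla ,
  Join.isChromaticNumber-join G G isχ isχ

a*x+a*x≡[2*a]*x : ∀ a x → a * x + a * x ≡ (2 * a) * x
a*x+a*x≡[2*a]*x a x = sym (trans (*-assoc 2 a x) (cong (a * x +_) (+-identityʳ (a * x))))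

2^[1+i]∸1 : ∀ i → 2 ^ suc i ∸ 1 ≡ (2 ^ i ∸ 1) + 2 ^ i
2^[1+i]∸1 i = trans (cong (λ x → 2 ^ i + x ∸ 1) (+-identityʳ (2 ^ i))) (+-∸-comm (2 ^ i) (m^n>0 2 i))

iterate : ∀ {p r χ} (G : Graph p) → 2 ≤ r → Regular G r →
  IsLocalAntimagicChromaticNumber G χ → IsChromaticNumber G χ → ∀ i →
  dbl i p ≡ 2 ^ i * p ×
  Regular (iter i G) (r + (2 ^ i ∸ 1) * p) ×
  IsLocalAntimagicChromaticNumber (iter i G) (2 ^ i * χ) ×
  IsChromaticNumber (iter i G) (2 ^ i * χ)
iterate {p} {r} {χ} G 2≤r regular isχla isχ zero =
  sym (+-identityʳ p) ,
  subst (Regular G) (sym (+-identityʳ r)) regular ,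
  subst (IsLocalAntimagicChromaticNumber G) (sym (+-identityʳ χ)) isχla ,
  subst (IsChromaticNumber G) (sym (+-identityʳ χ)) isχ
iterate {p} {r} {χ} G 2≤r regular isχla isχ (suc i) =
  trans (cong₂ _+_ order≡ order≡) (a*x+a*x≡[2*a]*x (2 ^ i) p) ,
  subst (Regular (iter (suc i) G)) degree≡ (proj₁ step) ,
  subst (IsLocalAntimagicChromaticNumber (iter (suc i) G)) (a*x+a*x≡[2*a]*x (2 ^ i) χ) (proj₁ (proj₂ step)) ,
  subst (IsChromaticNumber (iter (suc i) G)) (a*x+a*x≡[2*a]*x (2 ^ i) χ) (proj₂ (proj₂ step))
  where
  previous = iterate G 2≤r regular isχla isχ i
  order≡ = proj₁ previous
  step = join-step (iter i G) (≤-trans 2≤r (m≤m+n r _))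
           (proj₁ (proj₂ previous)) (proj₁ (proj₂ (proj₂ previous))) (proj₂ (proj₂ (proj₂ previous)))
  degree≡ : r + (2 ^ i ∸ 1) * p + dbl i p ≡ r + (2 ^ suc i ∸ 1) * p
  degree≡ = begin
    r + (2 ^ i ∸ 1) * p + dbl i p      ≡⟨ cong (r + (2 ^ i ∸ 1) * p +_) order≡ ⟩
    r + (2 ^ i ∸ 1) * p + 2 ^ i * p    ≡⟨ +-assoc r _ _ ⟩
    r + ((2 ^ i ∸ 1) * p + 2 ^ i * p)  ≡⟨ cong (r +_) (sym (*-distribʳ-+ p (2 ^ i ∸ 1) (2 ^ i))) ⟩
    r + ((2 ^ i ∸ 1) + 2 ^ i) * p      ≡⟨ cong (λ e → r + e * p) (sym (2^[1+i]∸1 i)) ⟩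
    r + (2 ^ suc i ∸ 1) * p            ∎
    where open ≡-Reasoning

corollary3p16 : ∀ (p r χ : ℕ) (G : Graph p) →
    2 ≤ r → Regular G r →
    IsLocalAntimagicChromaticNumber G χ → IsChromaticNumber G χ →
    ∀ (k : ℕ) → 2 ≤ k →
      dbl (k ∸ 1) p ≡ 2 ^ (k ∸ 1) * p ×
      Regular (iter (k ∸ 1) G) (r + (2 ^ (k ∸ 1) ∸ 1) * p) ×
      IsLocalAntimagicChromaticNumber (iter (k ∸ 1) G) (2 ^ (k ∸ 1) * χ) ×
      IsChromaticNumber (iter (k ∸ 1) G) (2 ^ (k ∸ 1) * χ)
corollary3p16 p r χ G 2≤r regular isχla isχ k _ = iterate G 2≤r regular isχla isχ (k ∸ 1)
-- The hypothesis 2 ≤ k is not needed: the case k = 1 is iter 0 G = G.
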